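{- For any $d>0$, on coordinate structures, every sentence of $\mathrm{ESO}(\mathrm{var}\ d)$ is equivalent to a sentence of $\mathrm{ESO}(\forall^d,\mathrm{arity}\ d)$: for every $k\ge1$, every finite alphabet $\Sigma$ and every $\Phi\in\mathrm{ESO}(\mathrm{var}\ d)$ over the signature of coordinate structures of $k$-pictures over $\Sigma$, there exists $\Phi'\in\mathrm{ESO}(\forall^d,\mathrm{arity}\ d)$ such that for every $k$-picture $p$ over $\Sigma$, $\mathrm{coord}^k(p)\models\Phi$ iff $\mathrm{coord}^k(p)\models\Phi'$.
   Context: For $n\ge1$ let $[n]=\{1,\dots,n\}$. A $k$-picture over $\Sigma$ is a map $p:[n]^k\to\Sigma$. The coordinate structure $\mathrm{coord}^k(p)$ has domain $[n]$, $k$-ary relations $Q_s=\{a\in[n]^k:p(a)=s\}$ ($s\in\Sigma$), the usual order $<$, unary relations $\min=\{1\}$, $\max=\{n\}$, and the unary function $\mathrm{succ}$ with $\mathrm{succ}(i)=i+1$ for $i<n$, $\mathrm{succ}(n)=1$. $\mathrm{ESO}(\forall^d,\mathrm{arity}\ \ell)$ is the set of sentences $\exists R_1\dots\exists R_m\,\forall x_1\dots\forall x_d\,\theta$, $R_j$ relation symbols of arity at most $\ell$, $\theta$ quantifier-free. $\mathrm{ESO}(\mathrm{var}\ d)$ is the set of sentences $\exists R_1\dots\exists R_m\,\varphi$, $R_j$ relation symbols of any arity, $\varphi$ a first-order formula using at most $d$ distinct first-order variables (possibly requantified). -}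

module Defs where

open import Data.Nat using (ℕ; zero; suc; _≤_; _<?_)
open import Data.Fin using (Fin; zero; suc; toℕ; fromℕ<; _≟_) renaming (_<_ to _<ᶠ_)
open import Data.Vec using (Vec; map)
open import Data.Vec.Relation.Unary.All using () renaming (All to AllV)
open import Data.List using (List; length; lookup)
open import Data.List.Relation.Unary.All using (All)
open import Data.Bool using (Bool; true; false; T; if_then_else_)
open import Data.Product using (Σ; _×_)
open import Data.Sum using (_⊎_)
open import Data.Unit using (⊤)
open import Relation.Nullary using (¬_; yes; no; does)
open import Relation.Binary.PropositionalEquality using (_≡_)

-- Signature of coord^k(p) for alphabet Σ = Fin s:
--   k-ary Q_c (c : Fin s), <, unary min, max, unary function succ,
-- plus equality, plus second-order (existentially quantified) relation
-- symbols whose arities are listed in Γ.  First-order variables are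
-- drawn from Fin d (so at most d distinct variables, re-quantifiable).

data Term (d : ℕ) : Set where
  var  : Fin d → Term d
  succ : Term d → Term d

data Formula (k s d : ℕ) (Γ : List ℕ) : Set where
  pic   : Fin s → Vec (Term d) k → Formula k s d Γ
  rel   : (j : Fin (length Γ)) → Vec (Term d) (lookup Γ j) → Formula k s d Γ
  _≐_   : Term d → Term d → Formula k s d Γ
  _≺_   : Term d → Term d → Formula k s d Γ
  isMin : Term d → Formula k s d Γ
  isMax : Term d → Formula k s d Γ
  ¬ᶠ_   : Formula k s d Γ → Formula k s d Γ
  _∧ᶠ_  : Formula k s d Γ → Formula k s d Γ → Formula k s d Γ
  _∨ᶠ_  : Formula k s d Γ → Formula k s d Γ → Formula k s d Γ
  ∀ᶠ    : Fin d → Formula k s d Γ → Formula k s d Γ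
  ∃ᶠ    : Fin d → Formula k s d Γ → Formula k s d Γ

data QuantifierFree {k s d : ℕ} {Γ : List ℕ} : Formula k s d Γ → Set where
  pic   : ∀ c ts → QuantifierFree (pic c ts)
  rel   : ∀ j ts → QuantifierFree (rel j ts)
  eq    : ∀ t u → QuantifierFree (t ≐ u)
  lt    : ∀ t u → QuantifierFree (t ≺ u)
  isMin : ∀ t → QuantifierFree (isMin t)
  isMax : ∀ t → QuantifierFree (isMax t)
  neg   : ∀ {φ} → QuantifierFree φ → QuantifierFree (¬ᶠ φ)
  conj  : ∀ {φ ψ} → QuantifierFree φ → QuantifierFree ψ → QuantifierFree (φ ∧ᶠ ψ)
  disj  : ∀ {φ ψ} → QuantifierFree φ → QuantifierFree ψ → QuantifierFree (φ ∨ᶠ ψ)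

bindVar : ∀ {d} → Fin d → (Fin d → Bool) → Fin d → Bool
bindVar x B y = if does (x ≟ y) then true else B y

TermBound : ∀ {d} → (Fin d → Bool) → Term d → Set
TermBound B (var x)  = T (B x)
TermBound B (succ t) = TermBound B t

ClosedUnder : ∀ {k s d Γ} → (Fin d → Bool) → Formula k s d Γ → Set
ClosedUnder B (pic c ts)  = AllV (TermBound B) ts
ClosedUnder B (rel j ts)  = AllV (TermBound B) ts
ClosedUnder B (t ≐ u)     = TermBound B t × TermBound B u
ClosedUnder B (t ≺ u)     = TermBound B t × TermBound B u
ClosedUnder B (isMin t)   = TermBound B t
ClosedUnder B (isMax t)   = TermBound B t
ClosedUnder B (¬ᶠ φ)      = ClosedUnder B φ
ClosedUnder B (φ ∧ᶠ ψ)    = ClosedUnder B φ × ClosedUnder B ψ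
ClosedUnder B (φ ∨ᶠ ψ)    = ClosedUnder B φ × ClosedUnder B ψ
ClosedUnder B (∀ᶠ x φ)    = ClosedUnder (bindVar x B) φ
ClosedUnder B (∃ᶠ x φ)    = ClosedUnder (bindVar x B) φ

Closed : ∀ {k s d Γ} → Formula k s d Γ → Set
Closed = ClosedUnder (λ _ → false)

-- Semantics on coord^k(p), p a k-picture of size n = suc m,
-- domain [n] represented as Fin (suc m) (element i ↦ i+1).

Picture : (k s m : ℕ) → Set
Picture k s m = Vec (Fin (suc m)) k → Fin s

csucc : ∀ {m} → Fin (suc m) → Fin (suc m)
csucc {m} i with toℕ i <? m
... | yes p = suc (fromℕ< p)
... | no  _ = zero

Interp : (m : ℕ) → List ℕ → Set
Interp m Γ = (j : Fin (length Γ)) → Vec (Fin (suc m)) (lookup Γ j) → Bool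

Assignment : (m d : ℕ) → Set
Assignment m d = Fin d → Fin (suc m)

update : ∀ {m d} → Assignment m d → Fin d → Fin (suc m) → Assignment m d
update ρ x a y = if does (x ≟ y) then a else ρ y

evalT : ∀ {m d} → Assignment m d → Term d → Fin (suc m)
evalT ρ (var x)  = ρ x
evalT ρ (succ t) = csucc (evalT ρ t)

Sat : ∀ {k s m d Γ} → Picture k s m → Interp m Γ → Assignment m d → Formula k s d Γ → Set
Sat p I ρ (pic c ts) = p (map (evalT ρ) ts) ≡ c
Sat p I ρ (rel j ts) = T (I j (map (evalT ρ) ts))
Sat p I ρ (t ≐ u)    = evalT ρ t ≡ evalT ρ u
Sat p I ρ (t ≺ u)    = evalT ρ t <ᶠ evalT ρ u
Sat p I ρ (isMin t)  = toℕ (evalT ρ t) ≡ 0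
Sat {m = m} p I ρ (isMax t) = toℕ (evalT ρ t) ≡ m
Sat p I ρ (¬ᶠ φ)     = ¬ Sat p I ρ φ
Sat p I ρ (φ ∧ᶠ ψ)   = Sat p I ρ φ × Sat p I ρ ψ
Sat p I ρ (φ ∨ᶠ ψ)   = Sat p I ρ φ ⊎ Sat p I ρ ψ
Sat p I ρ (∀ᶠ x φ)   = (a : Fin (suc _)) → Sat p I (update ρ x a) φ
Sat p I ρ (∃ᶠ x φ)   = Σ (Fin (suc _)) λ a → Sat p I (update ρ x a) φ

-- ESO(var d): ∃R₁…∃R_m φ, R_j of any arity, φ a FO sentence with
-- variables among d variables.

record ESOvar (k s d : ℕ) : Set where
  field
    arities : List ℕ
    body    : Formula k s d arities
    closed  : Closed body

-- coord^k(p) ⊨ Φ  (assignment is irrelevant since body is closed)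
_⊨var_ : ∀ {k s m d} → Picture k s m → ESOvar k s d → Set
_⊨var_ {m = m} p Φ =
  Σ (Interp m (ESOvar.arities Φ)) λ I → Sat p I (λ _ → zero) (ESOvar.body Φ)

-- ESO(∀^d, arity ℓ): ∃R₁…∃R_m ∀x₁…∀x_d θ, arities ≤ ℓ, θ quantifier-free.
record ESOforall (k s d ℓ : ℕ) : Set where
  field
    arities    : List ℕ
    arityBound : All (_≤ ℓ) arities
    matrix     : Formula k s d arities
    qf         : QuantifierFree matrix

_⊨∀_ : ∀ {k s m d ℓ} → Picture k s m → ESOforall k s d ℓ → Set
_⊨∀_ {m = m} {d = d} p Φ =
  Σ (Interp m (ESOforall.arities Φ)) λ I →
    (ρ : Assignment m d) → Sat p I ρ (ESOforall.matrix Φ)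

-- With only d variables, relations of arity d can store arbitrary sets of assignments. Each
-- occurrence R(t̄) of a second-order relation and each quantified subformula ∃x θ gets fresh
-- d-ary relations ("slots"), and the matrix states universally, in the d variables, what they
-- must contain. For ∃x θ a slot S, "θ for some x ≤ the current x", is defined by recursion along
-- the cyclic successor from min to max, and a slot E, "θ for some x", equals S at max and is
-- invariant under changing x. Slots of two occurrences R(t̄), R(ū) must agree whenever t̄ and ū
-- take the same value; a single assignment c, shifted by powers of succ, encodes both sides of
-- that implication, and R is then read off the slots.

module Submission where

open import Defs
open import Data.Nat as ℕ using (ℕ; zero; suc; _+_; _∸_; _<?_; _<_; _≤_; z<s)
open import Data.Nat.Properties as ℕ
open import Data.Nat.GeneralisedArithmetic using (fold; fold-+)
open import Data.Fin as Fin using (Fin; zero; suc; toℕ; fromℕ<; fromℕ; inject₁)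
open import Data.Fin.Properties using (all?; any?; toℕ-cast; toℕ-injective; toℕ-fromℕ<; toℕ-fromℕ; toℕ-inject₁; toℕ<n)
open import Data.Vec as Vec using (Vec; []; _∷_; map; tabulate)
open import Data.Vec.Properties
  using (≡-dec; map-cong; lookup-map; tabulate-cong; tabulate∘lookup; tabulate-∘; lookup∘tabulate; map-cast; cast-trans; cast-is-id)
open import Data.Vec.Relation.Unary.Any as AnyV using (Any)
open import Data.Vec.Relation.Unary.Any.Properties using (lookup-index)
open import Data.Vec.Membership.Propositional using (lose)
open import Data.Vec.Membership.Propositional.Properties using (∈-lookup)
open import Data.Vec.Relation.Unary.All as AllV using ([]; _∷_)
open import Data.List as List using (List; length; lookup; _++_)
open import Data.List.Properties using (length-replicate)
open import Data.List.Relation.Unary.All.Properties using (replicate⁺)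
open import Data.List.Membership.Propositional using (_∈_; find) renaming (lose to loseL)
open import Data.List.Relation.Unary.Any as AnyL using ()
open import Data.List.Membership.Propositional.Properties using (∈-allFin; ∈-++⁺ˡ; ∈-++⁺ʳ; ∈-++⁻)
open import Data.List.Relation.Unary.Any using (here; there)
open import Data.Bool using (Bool; true; false; T; if_then_else_)
open import Data.Unit using (⊤; tt)
open import Data.Product using (Σ; ∃; _×_; _,_; proj₁; proj₂)
open import Data.Product.Function.NonDependent.Propositional using (_×-⇔_)
open import Data.Sum as Sum using (_⊎_; inj₁; inj₂; [_,_]′)
open import Data.Sum.Function.Propositional using (_⊎-⇔_)
open import Data.Empty using (⊥-elim)
open import Function using (_∘_; id)
open import Function.Bundles using (_⇔_; mk⇔; Equivalence)
open import Function.Related.TypeIsomorphisms using (¬-cong-⇔)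
open import Function.Related.Propositional using (module EquationalReasoning; equivalence)
open import Function.Construct.Symmetry using (⇔-sym)
open import Function.Construct.Composition using (_⇔-∘_)
open import Function.Construct.Identity using (⇔-id)
open import Relation.Nullary using (¬_; yes; no; Dec; does)
open import Relation.Nullary.Decidable using (map′; T?; ¬?; _×-dec_; _⊎-dec_; decidable-stable)
open import Relation.Binary.Definitions using (_Respects_)
open import Relation.Binary.PropositionalEquality hiding (J)

vec-ext : ∀ {A : Set} {n} {xs ys : Vec A n} → (∀ i → Vec.lookup xs i ≡ Vec.lookup ys i) → xs ≡ ys
vec-ext {xs = xs} {ys} xs≗ys = trans (sym (tabulate∘lookup xs)) (trans (tabulate-cong xs≗ys) (tabulate∘lookup ys))

infixr 9 _∘⇔_

_∘⇔_ : ∀ {A B C : Set} → B ⇔ C → A ⇔ B → A ⇔ C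
_∘⇔_ = _⇔-∘_

⇔-subst : ∀ {A : Set} (P : A → Set) {a b : A} → a ≡ b → P a ⇔ P b
⇔-subst P a≡b = mk⇔ (subst P a≡b) (subst P (sym a≡b))

⇔-subst₂ : ∀ {A B : Set} (P : A → B → Set) {a a′ b b′} → a ≡ a′ → b ≡ b′ → P a b ⇔ P a′ b′
⇔-subst₂ P a≡a′ b≡b′ = mk⇔ (subst₂ P a≡a′ b≡b′) (subst₂ P (sym a≡a′) (sym b≡b′))

respects⇒⇔ : ∀ {A B : Set} {P : (A → B) → Set} → P Respects _≗_ → ∀ {f g} → f ≗ g → P f ⇔ P g
respects⇒⇔ resp f≗g = mk⇔ (resp f≗g) (resp (sym ∘ f≗g))

T-does : ∀ {A : Set} (A? : Dec A) → T (does A?) ⇔ A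
T-does (yes a) = mk⇔ (λ _ → a) (λ _ → tt)
T-does (no ¬a) = mk⇔ (λ ()) ¬a

¬∃¬⇔∀ : ∀ {A : Set} {P : A → Set} → (∀ a → Dec (P a)) → (¬ ∃ λ a → ¬ P a) ⇔ (∀ a → P a)
¬∃¬⇔∀ P? = mk⇔ (λ ¬∃¬ a → decidable-stable (P? a) (λ ¬Pa → ¬∃¬ (a , ¬Pa))) (λ ∀P (a , ¬Pa) → ¬Pa (∀P a))

∃-Vec? : ∀ {n} r {P : Vec (Fin n) r → Set} → (∀ v → Dec (P v)) → Dec (∃ P)
∃-Vec? zero    P? = map′ ([] ,_) (λ { ([] , Pv) → Pv }) (P? [])
∃-Vec? (suc r) P? = map′ (λ { (a , v , Pv) → a ∷ v , Pv }) (λ { (a ∷ v , Pv) → a , v , Pv })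
                         (any? λ a → ∃-Vec? r (λ v → P? (a ∷ v)))

lookup-replicate′ : ∀ {A : Set} n (a : A) (j : Fin (length (List.replicate n a))) → lookup (List.replicate n a) j ≡ a
lookup-replicate′ (suc n) a zero    = refl
lookup-replicate′ (suc n) a (suc j) = lookup-replicate′ n a j

csucc^ : ∀ {m} → ℕ → Fin (suc m) → Fin (suc m)
csucc^ j a = fold a csucc j

toℕ-csucc : ∀ {m} (a : Fin (suc m)) → toℕ a < m → toℕ (csucc a) ≡ suc (toℕ a)
toℕ-csucc {m} a a<m with toℕ a <? m
... | yes a<m′ = cong suc (toℕ-fromℕ< a<m′)
... | no  a≮m  = ⊥-elim (a≮m a<m)

csucc-last : ∀ {m} (a : Fin (suc m)) → toℕ a ≡ m → csucc a ≡ zero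
csucc-last {m} a a≡m with toℕ a <? m
... | yes a<m = ⊥-elim (ℕ.<-irrefl a≡m a<m)
... | no  _   = refl

cpred : ∀ {m} → Fin (suc m) → Fin (suc m)
cpred {m} zero = fromℕ m
cpred (suc i)  = inject₁ i

csucc-cpred : ∀ {m} (a : Fin (suc m)) → csucc (cpred a) ≡ a
csucc-cpred {m} zero = csucc-last (fromℕ m) (toℕ-fromℕ m)
csucc-cpred {suc m} (suc i) = toℕ-injective (begin
  toℕ (csucc (inject₁ i)) ≡⟨ toℕ-csucc (inject₁ i) (subst (_< suc m) (sym (toℕ-inject₁ i)) (toℕ<n i)) ⟩
  suc (toℕ (inject₁ i))   ≡⟨ cong suc (toℕ-inject₁ i) ⟩
  suc (toℕ i)             ∎)
  where open ≡-Reasoning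

cpred-csucc : ∀ {m} (a : Fin (suc m)) → cpred (csucc a) ≡ a
cpred-csucc {m} a with toℕ a <? m
... | yes a<m = toℕ-injective (trans (toℕ-inject₁ (fromℕ< a<m)) (toℕ-fromℕ< a<m))
... | no  a≮m = toℕ-injective (trans (toℕ-fromℕ m) (sym (ℕ.≤-antisym (ℕ.≤-pred (toℕ<n a)) (ℕ.≮⇒≥ a≮m))))

toℕ-cpred : ∀ {m i} (a : Fin (suc m)) → toℕ a ≡ suc i → toℕ (cpred a) ≡ i
toℕ-cpred (suc j) a≡1+i = trans (toℕ-inject₁ j) (ℕ.suc-injective a≡1+i)

csucc-injective : ∀ {m} {a b : Fin (suc m)} → csucc a ≡ csucc b → a ≡ b
csucc-injective {a = a} {b} e = trans (sym (cpred-csucc a)) (trans (cong cpred e) (cpred-csucc b))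

csucc^-injective : ∀ {m} j {a b : Fin (suc m)} → csucc^ j a ≡ csucc^ j b → a ≡ b
csucc^-injective zero    e = e
csucc^-injective (suc j) e = csucc^-injective j (csucc-injective e)

csucc^-+ : ∀ {m} i j (a : Fin (suc m)) → csucc^ (i + j) a ≡ csucc^ i (csucc^ j a)
csucc^-+ i j a = fold-+ a csucc i

csucc^-suc : ∀ {m} j (a : Fin (suc m)) → csucc^ (suc j) a ≡ csucc^ j (csucc a)
csucc^-suc j a = trans (cong (λ n → csucc^ n a) (ℕ.+-comm 1 j)) (csucc^-+ j 1 a)

cpred^ : ∀ {m} → ℕ → Fin (suc m) → Fin (suc m)
cpred^ j a = fold a cpred j

csucc^-cpred^ : ∀ {m} j (a : Fin (suc m)) → csucc^ j (cpred^ j a) ≡ a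
csucc^-cpred^ zero    a = refl
csucc^-cpred^ (suc j) a = begin
  csucc^ (suc j) (cpred (cpred^ j a))   ≡⟨ csucc^-suc j _ ⟩
  csucc^ j (csucc (cpred (cpred^ j a))) ≡⟨ cong (csucc^ j) (csucc-cpred _) ⟩
  csucc^ j (cpred^ j a)                 ≡⟨ csucc^-cpred^ j a ⟩
  a                                     ∎
  where open ≡-Reasoning

csucc^-shift : ∀ {m} {j K} l (a : Fin (suc m)) → j ≤ K → csucc^ j (csucc^ (K ∸ j + l) a) ≡ csucc^ l (csucc^ K a)
csucc^-shift {j = j} {K} l a j≤K = begin
  csucc^ j (csucc^ (K ∸ j + l) a) ≡⟨ csucc^-+ j _ a ⟨
  csucc^ (j + (K ∸ j + l)) a      ≡⟨ cong (λ n → csucc^ n a) j+[K∸j+l]≡l+K ⟩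
  csucc^ (l + K) a                ≡⟨ csucc^-+ l K a ⟩
  csucc^ l (csucc^ K a)           ∎
  where
  open ≡-Reasoning
  j+[K∸j+l]≡l+K : j + (K ∸ j + l) ≡ l + K
  j+[K∸j+l]≡l+K = trans (sym (ℕ.+-assoc j _ l)) (trans (cong (_+ l) (ℕ.m+[n∸m]≡n j≤K)) (ℕ.+-comm K l))

toℕ-csucc^ : ∀ {m} i (a : Fin (suc m)) → toℕ a + i ≤ m → toℕ (csucc^ i a) ≡ toℕ a + i
toℕ-csucc^ zero    a _ = sym (ℕ.+-identityʳ _)
toℕ-csucc^ {m} (suc i) a a+1+i≤m = begin
  toℕ (csucc (csucc^ i a)) ≡⟨ toℕ-csucc _ (subst (_< m) (sym ih) a+i<m) ⟩
  suc (toℕ (csucc^ i a))   ≡⟨ cong suc ih ⟩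
  suc (toℕ a + i)          ≡⟨ ℕ.+-suc (toℕ a) i ⟨
  toℕ a + suc i            ∎
  where
  open ≡-Reasoning
  a+i<m : toℕ a + i < m
  a+i<m = subst (_≤ m) (ℕ.+-suc (toℕ a) i) a+1+i≤m
  ih : toℕ (csucc^ i a) ≡ toℕ a + i
  ih = toℕ-csucc^ i a (ℕ.<⇒≤ a+i<m)

-- Go up to the last element, wrap around to 0, then go up to b.
csucc^-reaches : ∀ {m} (a b : Fin (suc m)) → ∃ λ j → csucc^ j a ≡ b
csucc^-reaches {m} a b = toℕ b + suc (m ∸ toℕ a) , (begin
  csucc^ (toℕ b + suc (m ∸ toℕ a)) a           ≡⟨ csucc^-+ (toℕ b) _ a ⟩
  csucc^ (toℕ b) (csucc (csucc^ (m ∸ toℕ a) a)) ≡⟨ cong (csucc^ (toℕ b)) (csucc-last _ a↑m) ⟩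
  csucc^ (toℕ b) zero                           ≡⟨ toℕ-injective (toℕ-csucc^ (toℕ b) zero (ℕ.≤-pred (toℕ<n b))) ⟩
  b                                             ∎)
  where
  open ≡-Reasoning
  a+[m∸a]≡m : toℕ a + (m ∸ toℕ a) ≡ m
  a+[m∸a]≡m = ℕ.m+[n∸m]≡n (ℕ.≤-pred (toℕ<n a))
  a↑m : toℕ (csucc^ (m ∸ toℕ a) a) ≡ m
  a↑m = trans (toℕ-csucc^ _ a (ℕ.≤-reflexive a+[m∸a]≡m)) a+[m∸a]≡m

incr : ∀ {m d} → Fin d → Assignment m d → Assignment m d
incr x ρ = update ρ x (csucc (ρ x))

module _ {m d : ℕ} where

  update-≡ : ∀ (ρ : Assignment m d) x a → update ρ x a x ≡ a
  update-≡ ρ x a with x Fin.≟ x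
  ... | yes _  = refl
  ... | no x≢x = ⊥-elim (x≢x refl)

  update-≢ : ∀ (ρ : Assignment m d) {x y} a → x ≢ y → update ρ x a y ≡ ρ y
  update-≢ ρ {x} {y} a x≢y with x Fin.≟ y
  ... | yes x≡y = ⊥-elim (x≢y x≡y)
  ... | no _    = refl

  update-update : ∀ (ρ : Assignment m d) x a b → update (update ρ x a) x b ≗ update ρ x b
  update-update ρ x a b y with x Fin.≟ y
  ... | yes _ = refl
  ... | no _  = refl

  update-self : ∀ (ρ : Assignment m d) x → update ρ x (ρ x) ≗ ρ
  update-self ρ x y with x Fin.≟ y
  ... | yes refl = refl
  ... | no _     = refl

  update-cong : ∀ {ρ ρ′ : Assignment m d} → ρ ≗ ρ′ → ∀ x a → update ρ x a ≗ update ρ′ x a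
  update-cong ρ≗ρ′ x a y with x Fin.≟ y
  ... | yes _ = refl
  ... | no _  = ρ≗ρ′ y

  incr-cpred : ∀ (ρ : Assignment m d) x → incr x (update ρ x (cpred (ρ x))) ≗ ρ
  incr-cpred ρ x y = begin
    update ρ₀ x (csucc (ρ₀ x)) y        ≡⟨ update-update ρ x _ _ y ⟩
    update ρ x (csucc (ρ₀ x)) y         ≡⟨ cong (λ a → update ρ x (csucc a) y) (update-≡ ρ x _) ⟩
    update ρ x (csucc (cpred (ρ x))) y  ≡⟨ cong (λ a → update ρ x a y) (csucc-cpred (ρ x)) ⟩
    update ρ x (ρ x) y                  ≡⟨ update-self ρ x y ⟩
    ρ y                                 ∎
    where
    open ≡-Reasoning
    ρ₀ = update ρ x (cpred (ρ x))

  update-invariant : ∀ {P : Assignment m d → Set} → P Respects _≗_ → ∀ y →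
                     (∀ ρ → P ρ → P (incr y ρ)) →
                     ∀ ρ a → P ρ → P (update ρ y a)
  update-invariant {P} resp y step ρ a Pρ =
    subst (P ∘ update ρ y) (proj₂ (csucc^-reaches (ρ y) a)) (go (proj₁ (csucc^-reaches (ρ y) a)))
    where
    go : ∀ j → P (update ρ y (csucc^ j (ρ y)))
    go zero    = resp (λ z → sym (update-self ρ y z)) Pρ
    go (suc j) = subst (λ b → P (update ρ y (csucc b))) (update-≡ ρ y _)
                   (resp (update-update ρ y _ _) (step _ (go j)))

  updates-invariant : ∀ {P : Assignment m d → Set} {Free : Fin d → Set} → P Respects _≗_ →
                      (∀ y → Free y → ∀ ρ → P ρ → P (incr y ρ)) →
                      ∀ {ρ ρ′} → (∀ y → ρ y ≡ ρ′ y ⊎ Free y) → P ρ → P ρ′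
  updates-invariant {P} {Free} resp free {ρ} {ρ′} agree =
    go (List.allFin d) ρ (λ y → Sum.map₂ (∈-allFin y ,_) (agree y))
    where
    go : ∀ L ρ₁ → (∀ y → ρ₁ y ≡ ρ′ y ⊎ (y ∈ L × Free y)) → P ρ₁ → P ρ′
    go List.[]       ρ₁ agree₁ Pρ₁ = resp (λ y → [ id , (λ { (() , _) }) ]′ (agree₁ y)) Pρ₁
    go (y List.∷ L) ρ₁ agree₁ Pρ₁ = go L (update ρ₁ y (ρ′ y)) agree₂ P-updated
      where
      P-updated : P (update ρ₁ y (ρ′ y))
      P-updated with agree₁ y
      ... | inj₁ ρ₁y≡ρ′y     = subst (P ∘ update ρ₁ y) ρ₁y≡ρ′y (resp (sym ∘ update-self ρ₁ y) Pρ₁)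
      ... | inj₂ (_ , free-y) = update-invariant resp y (free y free-y) ρ₁ (ρ′ y) Pρ₁
      agree₂ : ∀ z → update ρ₁ y (ρ′ y) z ≡ ρ′ z ⊎ (z ∈ L × Free z)
      agree₂ z with y Fin.≟ z | agree₁ z
      ... | yes refl | _                        = inj₁ refl
      ... | no  _    | inj₁ ρ₁z≡ρ′z             = inj₁ ρ₁z≡ρ′z
      ... | no  y≢z  | inj₂ (here z≡y , _)      = ⊥-elim (y≢z (sym z≡y))
      ... | no  _    | inj₂ (there z∈L , free-z) = inj₂ (z∈L , free-z)

module _ {d : ℕ} where

  root : Term d → Fin d
  root (var x)  = x
  root (succ t) = root t

  depth : Term d → ℕ
  depth (var x)  = 0
  depth (succ t) = suc (depth t)

  succ^ : ℕ → Term d → Term d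
  succ^ zero    t = t
  succ^ (suc j) t = succ (succ^ j t)

  subT : (Fin d → Term d) → Term d → Term d
  subT σ (var x)  = σ x
  subT σ (succ t) = succ (subT σ t)

  next : Fin d → Fin d → Term d
  next x y = if does (x Fin.≟ y) then succ (var x) else var y

  module _ {m : ℕ} where

    evalT-cong : ∀ {ρ ρ′ : Assignment m d} → ρ ≗ ρ′ → evalT ρ ≗ evalT ρ′
    evalT-cong ρ≗ρ′ (var x)  = ρ≗ρ′ x
    evalT-cong ρ≗ρ′ (succ t) = cong csucc (evalT-cong ρ≗ρ′ t)

    evalT-root : ∀ (ρ : Assignment m d) t → evalT ρ t ≡ csucc^ (depth t) (ρ (root t))
    evalT-root ρ (var x)  = refl
    evalT-root ρ (succ t) = cong csucc (evalT-root ρ t)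

    evalT-root-cong : ∀ {ρ ρ′ : Assignment m d} t → ρ (root t) ≡ ρ′ (root t) → evalT ρ t ≡ evalT ρ′ t
    evalT-root-cong {ρ} {ρ′} t ρ≡ρ′ = trans (evalT-root ρ t) (trans (cong (csucc^ (depth t)) ρ≡ρ′) (sym (evalT-root ρ′ t)))

    evalT-succ^ : ∀ (ρ : Assignment m d) j t → evalT ρ (succ^ j t) ≡ csucc^ j (evalT ρ t)
    evalT-succ^ ρ zero    t = refl
    evalT-succ^ ρ (suc j) t = cong csucc (evalT-succ^ ρ j t)

    evalT-subT : ∀ (ρ : Assignment m d) σ t → evalT ρ (subT σ t) ≡ evalT (evalT ρ ∘ σ) t
    evalT-subT ρ σ (var x)  = refl
    evalT-subT ρ σ (succ t) = cong csucc (evalT-subT ρ σ t)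

    map-evalT-subT : ∀ {r} (ρ : Assignment m d) σ (ts : Vec (Term d) r) →
                     map (evalT ρ) (map (subT σ) ts) ≡ map (evalT (evalT ρ ∘ σ)) ts
    map-evalT-subT ρ σ []       = refl
    map-evalT-subT ρ σ (t ∷ ts) = cong₂ _∷_ (evalT-subT ρ σ t) (map-evalT-subT ρ σ ts)

    evalT-next : ∀ (ρ : Assignment m d) x → evalT ρ ∘ next x ≗ incr x ρ
    evalT-next ρ x y with x Fin.≟ y
    ... | yes _ = refl
    ... | no _  = refl

    AgreeOn : (Fin d → Bool) → Assignment m d → Assignment m d → Set
    AgreeOn B ρ ρ′ = ∀ y → T (B y) → ρ y ≡ ρ′ y

    evalT-agree : ∀ {B ρ ρ′} → AgreeOn B ρ ρ′ → ∀ t → TermBound B t → evalT ρ t ≡ evalT ρ′ t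
    evalT-agree agree (var x)  x∈B = agree x x∈B
    evalT-agree agree (succ t) t∈B = cong csucc (evalT-agree agree t t∈B)

    map-evalT-agree : ∀ {r B ρ ρ′} → AgreeOn B ρ ρ′ → (ts : Vec (Term d) r) →
                      AllV.All (TermBound B) ts → map (evalT ρ) ts ≡ map (evalT ρ′) ts
    map-evalT-agree agree []       []            = refl
    map-evalT-agree agree (t ∷ ts) (t∈B ∷ ts∈B) = cong₂ _∷_ (evalT-agree agree t t∈B) (map-evalT-agree agree ts ts∈B)

    agreeOn-bindVar : ∀ {B ρ ρ′} → AgreeOn B ρ ρ′ → ∀ x a → AgreeOn (bindVar x B) (update ρ x a) (update ρ′ x a)
    agreeOn-bindVar agree x a y y∈B with x Fin.≟ y
    ... | yes _ = refl
    ... | no _  = agree y y∈B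

module _ {d : ℕ} where

  termBound-everywhere : ∀ {B : Fin d → Bool} → (∀ y → T (B y)) → ∀ t → TermBound B t
  termBound-everywhere all-B (var x)  = all-B x
  termBound-everywhere all-B (succ t) = termBound-everywhere all-B t

  bindVar-everywhere : ∀ {B : Fin d → Bool} → (∀ y → T (B y)) → ∀ x y → T (bindVar x B y)
  bindVar-everywhere all-B x y with x Fin.≟ y
  ... | yes _ = tt
  ... | no _  = all-B y

  closedUnder-everywhere : ∀ {k s Γ} {B : Fin d → Bool} → (∀ y → T (B y)) → (φ : Formula k s d Γ) → ClosedUnder B φ
  closedUnder-everywhere all-B (pic c ts) = AllV.universal (termBound-everywhere all-B) ts
  closedUnder-everywhere all-B (rel j ts) = AllV.universal (termBound-everywhere all-B) ts
  closedUnder-everywhere all-B (t ≐ u)    = termBound-everywhere all-B t , termBound-everywhere all-B u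
  closedUnder-everywhere all-B (t ≺ u)    = termBound-everywhere all-B t , termBound-everywhere all-B u
  closedUnder-everywhere all-B (isMin t)  = termBound-everywhere all-B t
  closedUnder-everywhere all-B (isMax t)  = termBound-everywhere all-B t
  closedUnder-everywhere all-B (¬ᶠ φ)     = closedUnder-everywhere all-B φ
  closedUnder-everywhere all-B (φ ∧ᶠ ψ)   = closedUnder-everywhere all-B φ , closedUnder-everywhere all-B ψ
  closedUnder-everywhere all-B (φ ∨ᶠ ψ)   = closedUnder-everywhere all-B φ , closedUnder-everywhere all-B ψ
  closedUnder-everywhere all-B (∀ᶠ x φ)   = closedUnder-everywhere (bindVar-everywhere all-B x) φ
  closedUnder-everywhere all-B (∃ᶠ x φ)   = closedUnder-everywhere (bindVar-everywhere all-B x) φ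

module _ {k s m d : ℕ} {Γ : List ℕ} (p : Picture k s m) (I : Interp m Γ) where

  Sat-agree : ∀ {B} {ρ ρ′ : Assignment m d} → AgreeOn B ρ ρ′ →
              (φ : Formula k s d Γ) → ClosedUnder B φ → Sat p I ρ φ → Sat p I ρ′ φ
  Sat-agree agree (pic c ts) ts∈B = trans (cong p (sym (map-evalT-agree agree ts ts∈B)))
  Sat-agree agree (rel j ts) ts∈B = subst (T ∘ I j) (map-evalT-agree agree ts ts∈B)
  Sat-agree agree (t ≐ u) (t∈B , u∈B) t≡u = trans (sym (evalT-agree agree t t∈B)) (trans t≡u (evalT-agree agree u u∈B))
  Sat-agree agree (t ≺ u) (t∈B , u∈B) = subst₂ Fin._<_ (evalT-agree agree t t∈B) (evalT-agree agree u u∈B)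
  Sat-agree agree (isMin t) t∈B = trans (cong toℕ (sym (evalT-agree agree t t∈B)))
  Sat-agree agree (isMax t) t∈B = trans (cong toℕ (sym (evalT-agree agree t t∈B)))
  Sat-agree agree (¬ᶠ φ) φ∈B ¬sat sat′ = ¬sat (Sat-agree (λ y y∈B → sym (agree y y∈B)) φ φ∈B sat′)
  Sat-agree agree (φ ∧ᶠ ψ) (φ∈B , ψ∈B) (satφ , satψ) = Sat-agree agree φ φ∈B satφ , Sat-agree agree ψ ψ∈B satψ
  Sat-agree agree (φ ∨ᶠ ψ) (φ∈B , ψ∈B) (inj₁ satφ) = inj₁ (Sat-agree agree φ φ∈B satφ)
  Sat-agree agree (φ ∨ᶠ ψ) (φ∈B , ψ∈B) (inj₂ satψ) = inj₂ (Sat-agree agree ψ ψ∈B satψ)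
  Sat-agree agree (∀ᶠ x φ) φ∈B sat a = Sat-agree (agreeOn-bindVar agree x a) φ φ∈B (sat a)
  Sat-agree agree (∃ᶠ x φ) φ∈B (a , sat) = a , Sat-agree (agreeOn-bindVar agree x a) φ φ∈B sat

  Sat-closed : ∀ (φ : Formula k s d Γ) → Closed φ → (ρ ρ′ : Assignment m d) → Sat p I ρ φ → Sat p I ρ′ φ
  Sat-closed φ closed ρ ρ′ = Sat-agree (λ _ ()) φ closed


  Sat-resp : ∀ (φ : Formula k s d Γ) → (λ ρ → Sat p I ρ φ) Respects _≗_
  Sat-resp φ ρ≗ρ′ = Sat-agree {B = λ _ → true} (λ y _ → ρ≗ρ′ y) φ (closedUnder-everywhere _ φ)

  ¬Sat-resp : ∀ (φ : Formula k s d Γ) → (λ ρ → ¬ Sat p I ρ φ) Respects _≗_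
  ¬Sat-resp φ ρ≗ρ′ ¬sat sat′ = ¬sat (Sat-resp φ (sym ∘ ρ≗ρ′) sat′)

  Sat-cong : ∀ (φ : Formula k s d Γ) {ρ ρ′} → ρ ≗ ρ′ → Sat p I ρ φ ⇔ Sat p I ρ′ φ
  Sat-cong φ = respects⇒⇔ (Sat-resp φ)

  Sat? : ∀ (ρ : Assignment m d) (φ : Formula k s d Γ) → Dec (Sat p I ρ φ)
  Sat? ρ (pic c ts) = p (map (evalT ρ) ts) Fin.≟ c
  Sat? ρ (rel j ts) = T? (I j (map (evalT ρ) ts))
  Sat? ρ (t ≐ u)    = evalT ρ t Fin.≟ evalT ρ u
  Sat? ρ (t ≺ u)    = evalT ρ t Fin.<? evalT ρ u
  Sat? ρ (isMin t)  = toℕ (evalT ρ t) ℕ.≟ 0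
  Sat? ρ (isMax t)  = toℕ (evalT ρ t) ℕ.≟ m
  Sat? ρ (¬ᶠ φ)     = ¬? (Sat? ρ φ)
  Sat? ρ (φ ∧ᶠ ψ)   = Sat? ρ φ ×-dec Sat? ρ ψ
  Sat? ρ (φ ∨ᶠ ψ)   = Sat? ρ φ ⊎-dec Sat? ρ ψ
  Sat? ρ (∀ᶠ x φ)   = all? (λ a → Sat? (update ρ x a) φ)
  Sat? ρ (∃ᶠ x φ)   = any? (λ a → Sat? (update ρ x a) φ)

subF : ∀ {k s d Γ} {φ : Formula k s d Γ} → QuantifierFree φ → (Fin d → Term d) → Formula k s d Γ
subF (pic c ts) σ = pic c (map (subT σ) ts)
subF (rel j ts) σ = rel j (map (subT σ) ts)
subF (eq t u)   σ = subT σ t ≐ subT σ u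
subF (lt t u)   σ = subT σ t ≺ subT σ u
subF (isMin t)  σ = isMin (subT σ t)
subF (isMax t)  σ = isMax (subT σ t)
subF (neg φ)    σ = ¬ᶠ subF φ σ
subF (conj φ ψ) σ = subF φ σ ∧ᶠ subF ψ σ
subF (disj φ ψ) σ = subF φ σ ∨ᶠ subF ψ σ

subF-qf : ∀ {k s d Γ} {φ : Formula k s d Γ} (qf : QuantifierFree φ) σ → QuantifierFree (subF qf σ)
subF-qf (pic c ts) σ = pic c _
subF-qf (rel j ts) σ = rel j _
subF-qf (eq t u)   σ = eq _ _
subF-qf (lt t u)   σ = lt _ _
subF-qf (isMin t)  σ = isMin _
subF-qf (isMax t)  σ = isMax _
subF-qf (neg φ)    σ = neg (subF-qf φ σ)
subF-qf (conj φ ψ) σ = conj (subF-qf φ σ) (subF-qf ψ σ)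
subF-qf (disj φ ψ) σ = disj (subF-qf φ σ) (subF-qf ψ σ)

module _ {k s m d : ℕ} {Γ : List ℕ} (p : Picture k s m) (I : Interp m Γ) where

  Sat-subF : ∀ (ρ : Assignment m d) σ {φ : Formula k s d Γ} (qf : QuantifierFree φ) →
             Sat p I ρ (subF qf σ) ⇔ Sat p I (evalT ρ ∘ σ) φ
  Sat-subF ρ σ (pic c ts) = ⇔-subst (λ v → p v ≡ c) (map-evalT-subT ρ σ ts)
  Sat-subF ρ σ (rel j ts) = ⇔-subst (T ∘ I j) (map-evalT-subT ρ σ ts)
  Sat-subF ρ σ (eq t u)   = ⇔-subst₂ _≡_ (evalT-subT ρ σ t) (evalT-subT ρ σ u)
  Sat-subF ρ σ (lt t u)   = ⇔-subst₂ Fin._<_ (evalT-subT ρ σ t) (evalT-subT ρ σ u)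
  Sat-subF ρ σ (isMin t)  = ⇔-subst (λ a → toℕ a ≡ 0) (evalT-subT ρ σ t)
  Sat-subF ρ σ (isMax t)  = ⇔-subst (λ a → toℕ a ≡ m) (evalT-subT ρ σ t)
  Sat-subF ρ σ (neg φ)    = ¬-cong-⇔ (Sat-subF ρ σ φ)
  Sat-subF ρ σ (conj φ ψ) = Sat-subF ρ σ φ ×-⇔ Sat-subF ρ σ ψ
  Sat-subF ρ σ (disj φ ψ) = Sat-subF ρ σ φ ⊎-⇔ Sat-subF ρ σ ψ

-- S ρ: θ holds for some value of x up to ρ x; E ρ: θ holds for some value of x. Walking x
-- from 0 to the last element along the successor, these conditions pin S and E down.
record IsRunningExists {m d : ℕ} (x : Fin d) (Th S E : Assignment m d → Set) : Set where
  field
    S-resp : S Respects _≗_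
    E-resp : E Respects _≗_
    start  : ∀ ρ → toℕ (ρ x) ≡ 0 → S ρ ⇔ Th ρ
    step   : ∀ ρ → toℕ (ρ x) ≢ m → S (incr x ρ) ⇔ (S ρ ⊎ Th (incr x ρ))
    finish : ∀ ρ → toℕ (ρ x) ≡ m → E ρ ⇔ S ρ
    shift  : ∀ ρ → E ρ → E (incr x ρ)

IsRunningExists-cong : ∀ {m d} {x : Fin d} {Th S S′ E E′ : Assignment m d → Set} →
                       (∀ ρ → S ρ ⇔ S′ ρ) → (∀ ρ → E ρ ⇔ E′ ρ) → IsRunningExists x Th S E → IsRunningExists x Th S′ E′
IsRunningExists-cong S⇔S′ E⇔E′ running = record
  { S-resp = λ ρ≗ρ′ → Equivalence.to (S⇔S′ _) ∘ S-resp ρ≗ρ′ ∘ Equivalence.from (S⇔S′ _)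
  ; E-resp = λ ρ≗ρ′ → Equivalence.to (E⇔E′ _) ∘ E-resp ρ≗ρ′ ∘ Equivalence.from (E⇔E′ _)
  ; start  = λ ρ ρx≡0 → start ρ ρx≡0 ∘⇔ ⇔-sym (S⇔S′ ρ)
  ; step   = λ ρ ρx≢m → (S⇔S′ ρ ⊎-⇔ ⇔-id _) ∘⇔ step ρ ρx≢m ∘⇔ ⇔-sym (S⇔S′ _)
  ; finish = λ ρ ρx≡m → S⇔S′ ρ ∘⇔ finish ρ ρx≡m ∘⇔ ⇔-sym (E⇔E′ ρ)
  ; shift  = λ ρ → Equivalence.to (E⇔E′ _) ∘ shift ρ ∘ Equivalence.from (E⇔E′ ρ)
  }
  where open IsRunningExists running

module RunningExists {m d : ℕ} (x : Fin d) (Th : Assignment m d → Set) (Th-resp : Th Respects _≗_) where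

  Below : ℕ → Assignment m d → Set
  Below i ρ = ∃ λ a → toℕ a ≤ i × Th (update ρ x a)

  Exists : Assignment m d → Set
  Exists ρ = ∃ λ a → Th (update ρ x a)

  Below-update : ∀ i ρ b → Below i (update ρ x b) ⇔ Below i ρ
  Below-update i ρ b = mk⇔ (λ { (a , a≤i , th) → a , a≤i , Th-resp (update-update ρ x b a) th })
                           (λ { (a , a≤i , th) → a , a≤i , Th-resp (sym ∘ update-update ρ x b a) th })

  Below-zero : ∀ ρ → toℕ (ρ x) ≡ 0 → Below 0 ρ ⇔ Th ρ
  Below-zero ρ ρx≡0 = mk⇔
    (λ { (a , a≤0 , th) →
           Th-resp (update-self ρ x) (subst (Th ∘ update ρ x) (toℕ-injective (trans (ℕ.n≤0⇒n≡0 a≤0) (sym ρx≡0))) th) })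
    (λ th → ρ x , ℕ.≤-reflexive ρx≡0 , Th-resp (sym ∘ update-self ρ x) th)

  Below-suc : ∀ i ρ a → toℕ a ≡ suc i → Below (suc i) ρ ⇔ (Below i ρ ⊎ Th (update ρ x a))
  Below-suc i ρ a a≡1+i = mk⇔ to from
    where
    to : Below (suc i) ρ → Below i ρ ⊎ Th (update ρ x a)
    to (b , b≤1+i , th) with toℕ b ℕ.≤? i
    ... | yes b≤i = inj₁ (b , b≤i , th)
    ... | no  b≰i = inj₂ (subst (Th ∘ update ρ x) (toℕ-injective (trans (ℕ.≤-antisym b≤1+i (ℕ.≰⇒> b≰i)) (sym a≡1+i))) th)
    from : Below i ρ ⊎ Th (update ρ x a) → Below (suc i) ρ
    from (inj₁ (b , b≤i , th)) = b , ℕ.m≤n⇒m≤1+n b≤i , th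
    from (inj₂ th)             = a , ℕ.≤-reflexive a≡1+i , th

  Below-last : ∀ ρ → Below m ρ ⇔ Exists ρ
  Below-last ρ = mk⇔ (λ { (a , _ , th) → a , th }) (λ { (a , th) → a , ℕ.≤-pred (toℕ<n a) , th })

  Running : Assignment m d → Set
  Running ρ = Below (toℕ (ρ x)) ρ

  module _ {S E : Assignment m d → Set} (running : IsRunningExists x Th S E) where
    open IsRunningExists running
    open EquationalReasoning {k = equivalence}

    S⇔Below : ∀ i ρ → toℕ (ρ x) ≡ i → S ρ ⇔ Below i ρ
    S⇔Below zero    ρ ρx≡0 = ⇔-sym (Below-zero ρ ρx≡0) ∘⇔ start ρ ρx≡0
    S⇔Below (suc i) ρ ρx≡1+i = begin
      S ρ                                   ∼⟨ respects⇒⇔ S-resp (sym ∘ incr-cpred ρ x) ⟩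
      S (incr x ρ₀)                         ∼⟨ step ρ₀ ρ₀x≢m ⟩
      (S ρ₀ ⊎ Th (incr x ρ₀))               ∼⟨ (Below-update i ρ _ ∘⇔ S⇔Below i ρ₀ ρ₀x≡i)
                                               ⊎-⇔ respects⇒⇔ Th-resp (incr-cpred ρ x) ⟩
      (Below i ρ ⊎ Th ρ)                    ∼⟨ ⇔-id _ ⊎-⇔ respects⇒⇔ Th-resp (sym ∘ update-self ρ x) ⟩
      (Below i ρ ⊎ Th (update ρ x (ρ x)))   ∼⟨ ⇔-sym (Below-suc i ρ (ρ x) ρx≡1+i) ⟩
      Below (suc i) ρ                       ∎
      where
      ρ₀ = update ρ x (cpred (ρ x))
      ρ₀x≡i : toℕ (ρ₀ x) ≡ i
      ρ₀x≡i = trans (cong toℕ (update-≡ ρ x _)) (toℕ-cpred (ρ x) ρx≡1+i)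
      ρ₀x≢m : toℕ (ρ₀ x) ≢ m
      ρ₀x≢m ρ₀x≡m = ℕ.<-irrefl (trans (sym ρ₀x≡i) ρ₀x≡m) (subst (_≤ m) ρx≡1+i (ℕ.≤-pred (toℕ<n (ρ x))))

    running⇒exists : ∀ ρ → E ρ ⇔ Exists ρ
    running⇒exists ρ = begin
      E ρ          ∼⟨ mk⇔ (E-move ρ (fromℕ m)) (E-resp back ∘ E-move ρₘ (ρ x)) ⟩
      E ρₘ         ∼⟨ finish ρₘ ρₘx≡m ⟩
      S ρₘ         ∼⟨ S⇔Below m ρₘ ρₘx≡m ⟩
      Below m ρₘ   ∼⟨ Below-update m ρ _ ⟩
      Below m ρ    ∼⟨ Below-last ρ ⟩
      Exists ρ     ∎
      where
      ρₘ = update ρ x (fromℕ m)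
      ρₘx≡m : toℕ (ρₘ x) ≡ m
      ρₘx≡m = trans (cong toℕ (update-≡ ρ x _)) (toℕ-fromℕ m)
      E-move : ∀ ρ a → E ρ → E (update ρ x a)
      E-move = update-invariant E-resp x shift
      back : update ρₘ x (ρ x) ≗ ρ
      back y = trans (update-update ρ x _ _ y) (update-self ρ x y)

  Running-resp : Running Respects _≗_
  Running-resp ρ≗ρ′ (a , a≤ρx , th) = a , subst (toℕ a ≤_) (cong toℕ (ρ≗ρ′ x)) a≤ρx , Th-resp (update-cong ρ≗ρ′ x a) th

  Exists-resp : Exists Respects _≗_
  Exists-resp ρ≗ρ′ (a , th) = a , Th-resp (update-cong ρ≗ρ′ x a) th

  Exists-incr : ∀ ρ → Exists ρ → Exists (incr x ρ)
  Exists-incr ρ (a , th) = a , Th-resp (sym ∘ update-update ρ x _ a) th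

  Running-step : ∀ ρ → toℕ (ρ x) ≢ m → Running (incr x ρ) ⇔ (Running ρ ⊎ Th (incr x ρ))
  Running-step ρ ρx≢m = begin
    Running (incr x ρ)                                        ≡⟨ cong (λ i → Below i (incr x ρ)) incr-x ⟩
    Below (suc (toℕ (ρ x))) (incr x ρ)                         ∼⟨ Below-suc _ (incr x ρ) (csucc (ρ x)) (toℕ-csucc (ρ x) ρx<m) ⟩
    (Below (toℕ (ρ x)) (incr x ρ) ⊎ Th (update (incr x ρ) x (csucc (ρ x))))
                                                               ∼⟨ Below-update _ ρ _ ⊎-⇔ respects⇒⇔ Th-resp (update-update ρ x _ _) ⟩
    (Running ρ ⊎ Th (incr x ρ))                                ∎
    where
    open EquationalReasoning {k = equivalence}
    ρx<m : toℕ (ρ x) < m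
    ρx<m = ℕ.≤∧≢⇒< (ℕ.≤-pred (toℕ<n (ρ x))) ρx≢m
    incr-x : toℕ (incr x ρ x) ≡ suc (toℕ (ρ x))
    incr-x = trans (cong toℕ (update-≡ ρ x _)) (toℕ-csucc (ρ x) ρx<m)

  running : IsRunningExists x Th Running Exists
  running = record
    { S-resp = Running-resp
    ; E-resp = Exists-resp
    ; start  = λ ρ ρx≡0 → subst (λ i → Below i ρ ⇔ Th ρ) (sym ρx≡0) (Below-zero ρ ρx≡0)
    ; step   = Running-step
    ; finish = λ ρ ρx≡m → subst (λ i → Exists ρ ⇔ Below i ρ) (sym ρx≡m) (⇔-sym (Below-last ρ))
    ; shift  = Exists-incr
    }

  module _ (Th? : ∀ ρ → Dec (Th ρ)) where

    Running? : ∀ ρ → Dec (Running ρ)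
    Running? ρ = any? (λ a → (toℕ a ℕ.≤? toℕ (ρ x)) ×-dec Th? (update ρ x a))

    Exists? : ∀ ρ → Dec (Exists ρ)
    Exists? ρ = any? (λ a → Th? (update ρ x a))

module _ {d : ℕ} where

  RootedAt : Fin d → Term d → Set
  RootedAt y t = root t ≡ y

  occurs? : ∀ {r} (u : Vec (Term d) r) y → Dec (Any (RootedAt y) u)
  occurs? u y = AnyV.any? (λ t → root t Fin.≟ y) u

  occurs-lookup : ∀ {r} (u : Vec (Term d) r) i → Any (RootedAt (root (Vec.lookup u i))) u
  occurs-lookup u i = lose (∈-lookup i u) refl

  map-evalT-update-free : ∀ {m r} (u : Vec (Term d) r) {y} → ¬ Any (RootedAt y) u →
                          ∀ (ρ : Assignment m d) a → map (evalT (update ρ y a)) u ≡ map (evalT ρ) u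
  map-evalT-update-free []      y∉u ρ a = refl
  map-evalT-update-free (t ∷ u) y∉u ρ a =
    cong₂ _∷_ (evalT-root-cong t (update-≢ ρ a (λ y≡root → y∉u (AnyV.here (sym y≡root)))))
              (map-evalT-update-free u (y∉u ∘ AnyV.there) ρ a)

  depthSum : ∀ {r} → Vec (Term d) r → ℕ
  depthSum []       = 0
  depthSum (t ∷ ts) = depth t + depthSum ts

  depth≤depthSum : ∀ {r} (u : Vec (Term d) r) i → depth (Vec.lookup u i) ≤ depthSum u
  depth≤depthSum (t ∷ ts) zero    = ℕ.m≤m+n _ _
  depth≤depthSum (t ∷ ts) (suc i) = ℕ.≤-trans (depth≤depthSum ts i) (ℕ.m≤n+m _ _)

-- To force "Q at b and t̄(b) = ū(ρ) imply P at ρ" with only d variables, b and ρ are both read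
-- off one assignment c: b is succᴷ ∘ c (via α), and a variable y rooting the i-th term of ū is
-- sent (via β) to the successor-shift of c that makes the i-th terms agree; K = depthSum ū
-- keeps all shifts nonnegative. Variables not occurring in ū are handled by requiring P not to
-- depend on them.
module Transfer {d r : ℕ} (t u : Vec (Term d) r) where

  K : ℕ
  K = depthSum u

  α : Fin d → Term d
  α x = succ^ K (var x)

  βᵒ : ∀ y → Dec (Any (RootedAt y) u) → Term d
  βᵒ y (yes o) = succ^ (K ∸ depth (Vec.lookup u (AnyV.index o)) + depth (Vec.lookup t (AnyV.index o)))
                       (var (root (Vec.lookup t (AnyV.index o))))
  βᵒ y (no _)  = var y

  β : Fin d → Term d
  β y = βᵒ y (occurs? u y)

  module _ {m : ℕ} {P Q : Assignment m d → Set} (P-resp : P Respects _≗_) (Q-resp : Q Respects _≗_)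
           (pair : ∀ c → (∀ i → evalT (evalT c ∘ α) (Vec.lookup t i) ≡ evalT (evalT c ∘ β) (Vec.lookup u i)) →
                   Q (evalT c ∘ α) → P (evalT c ∘ β))
           (free : ∀ y → ¬ Any (RootedAt y) u → ∀ ρ → P ρ → P (incr y ρ)) where

    transfer : ∀ (b ρ : Assignment m d) → map (evalT b) t ≡ map (evalT ρ) u → Q b → P ρ
    transfer b ρ t[b]≡u[ρ] Qb =
      updates-invariant P-resp free (λ y → agreement y (occurs? u y)) (pair c guard (Q-resp (sym ∘ α-c) Qb))
      where
      t≡u : ∀ i → evalT b (Vec.lookup t i) ≡ evalT ρ (Vec.lookup u i)
      t≡u i = trans (sym (lookup-map i (evalT b) t)) (trans (cong (λ v → Vec.lookup v i) t[b]≡u[ρ]) (lookup-map i (evalT ρ) u))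

      c : Assignment m d
      c x = cpred^ K (b x)

      α-c : evalT c ∘ α ≗ b
      α-c x = trans (evalT-succ^ c K (var x)) (csucc^-cpred^ K (b x))

      γ : Assignment m d
      γ = evalT c ∘ β

      γ-occurring : ∀ y → Any (RootedAt y) u → γ y ≡ ρ y
      γ-occurring y y∈u with occurs? u y
      ... | no  y∉u = ⊥-elim (y∉u y∈u)
      ... | yes o   = csucc^-injective (depth uᵢ) (begin
        csucc^ (depth uᵢ) (evalT c (succ^ (K ∸ depth uᵢ + depth tᵢ) (var (root tᵢ))))
          ≡⟨ cong (csucc^ (depth uᵢ)) (evalT-succ^ c (K ∸ depth uᵢ + depth tᵢ) (var (root tᵢ))) ⟩
        csucc^ (depth uᵢ) (csucc^ (K ∸ depth uᵢ + depth tᵢ) (c (root tᵢ)))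
          ≡⟨ csucc^-shift (depth tᵢ) _ (depth≤depthSum u i) ⟩
        csucc^ (depth tᵢ) (csucc^ K (c (root tᵢ)))
          ≡⟨ cong (csucc^ (depth tᵢ)) (csucc^-cpred^ K _) ⟩
        csucc^ (depth tᵢ) (b (root tᵢ))
          ≡⟨ evalT-root b tᵢ ⟨
        evalT b tᵢ
          ≡⟨ t≡u i ⟩
        evalT ρ uᵢ
          ≡⟨ evalT-root ρ uᵢ ⟩
        csucc^ (depth uᵢ) (ρ (root uᵢ))
          ≡⟨ cong (csucc^ (depth uᵢ) ∘ ρ) (lookup-index o) ⟩
        csucc^ (depth uᵢ) (ρ y) ∎)
        where
        open ≡-Reasoning
        i  = AnyV.index o
        tᵢ = Vec.lookup t i
        uᵢ = Vec.lookup u i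

      guard : ∀ i → evalT (evalT c ∘ α) (Vec.lookup t i) ≡ evalT γ (Vec.lookup u i)
      guard i = trans (evalT-cong α-c (Vec.lookup t i))
                (trans (t≡u i) (evalT-root-cong (Vec.lookup u i) (sym (γ-occurring _ (occurs-lookup u i)))))

      agreement : ∀ y → Dec (Any (RootedAt y) u) → γ y ≡ ρ y ⊎ ¬ Any (RootedAt y) u
      agreement y (yes y∈u) = inj₁ (γ-occurring y y∈u)
      agreement y (no  y∉u) = inj₂ y∉u

-- The translated sentence uses N fresh relation symbols ("slots"), all of arity d.
-- x₀ is needed only to write down a true atomic formula; it exists because d > 0.
module Slots {k s d : ℕ} (x₀ : Fin d) (N : ℕ) where

  Γ′ : List ℕ
  Γ′ = List.replicate N d

  Formula′ : Set
  Formula′ = Formula k s d Γ′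

  SlotInterp : ℕ → Set
  SlotInterp m = ℕ → Vec (Fin (suc m)) d → Bool

  slotIndex : ∀ {i} → i < N → Fin (length Γ′)
  slotIndex i<N = Fin.cast (sym (length-replicate N)) (fromℕ< i<N)

  toℕ-slotIndex : ∀ {i} (i<N : i < N) → toℕ (slotIndex i<N) ≡ i
  toℕ-slotIndex i<N = trans (toℕ-cast _ (fromℕ< i<N)) (toℕ-fromℕ< i<N)

  slotArity : ∀ j → lookup Γ′ j ≡ d
  slotArity = lookup-replicate′ N d

  ⊤′ ⊥′ : Formula′
  ⊤′ = var x₀ ≐ var x₀
  ⊥′ = ¬ᶠ ⊤′

  infixr 6 _∧′_
  infixr 5 _⇒′_ _⇔′_

  _∧′_ _⇒′_ _⇔′_ : Formula′ → Formula′ → Formula′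
  φ ∧′ ψ = φ ∧ᶠ ψ
  φ ⇒′ ψ = (¬ᶠ φ) ∨ᶠ ψ
  φ ⇔′ ψ = (φ ⇒′ ψ) ∧ᶠ (ψ ⇒′ φ)

  ⋀ : List Formula′ → Formula′
  ⋀ List.[]       = ⊤′
  ⋀ (φ List.∷ φs) = φ ∧ᶠ ⋀ φs

  -- Slots with index ≥ N do not exist; they are read as false.
  slotᵈ : ∀ {i} → Dec (i < N) → (Fin d → Term d) → Formula′
  slotᵈ (yes i<N) σ = rel (slotIndex i<N) (Vec.cast (sym (slotArity _)) (tabulate σ))
  slotᵈ (no _)    σ = ⊥′

  slot : ℕ → (Fin d → Term d) → Formula′
  slot i = slotᵈ (i <? N)

  slotValueᵈ : ∀ {m i} → Interp m Γ′ → Dec (i < N) → Vec (Fin (suc m)) d → Bool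
  slotValueᵈ I′ (yes i<N) v = I′ (slotIndex i<N) (Vec.cast (sym (slotArity _)) v)
  slotValueᵈ I′ (no _)    v = false

  slotValue : ∀ {m} → Interp m Γ′ → SlotInterp m
  slotValue I′ i = slotValueᵈ I′ (i <? N)

  fromSlots : ∀ {m} → SlotInterp m → Interp m Γ′
  fromSlots J j v = J (toℕ j) (Vec.cast (slotArity j) v)

  slotValue-fromSlots : ∀ {m} (J : SlotInterp m) {i} → i < N → ∀ v → slotValue (fromSlots J) i v ≡ J i v
  slotValue-fromSlots J {i} i<N v with i <? N
  ... | no  i≮N  = ⊥-elim (i≮N i<N)
  ... | yes i<N′ = cong₂ J (toℕ-slotIndex i<N′) (trans (cast-trans _ _ v) (cast-is-id _ v))

  Holds : ∀ {m} → SlotInterp m → ℕ → Assignment m d → Set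
  Holds J i ρ = T (J i (tabulate ρ))

  Holds-resp : ∀ {m} (J : SlotInterp m) i → Holds J i Respects _≗_
  Holds-resp J i ρ≗ρ′ = subst (T ∘ J i) (tabulate-cong ρ≗ρ′)

  Holds-cong : ∀ {m} (J : SlotInterp m) i {ρ ρ′} → ρ ≗ ρ′ → Holds J i ρ ⇔ Holds J i ρ′
  Holds-cong J i = respects⇒⇔ (Holds-resp J i)

  Holds-≗ : ∀ {m} {J J′ : SlotInterp m} i → J i ≗ J′ i → ∀ ρ → Holds J i ρ ⇔ Holds J′ i ρ
  Holds-≗ i Ji≗J′i ρ = ⇔-subst T (Ji≗J′i (tabulate ρ))

  decide : ∀ {m} {P : Assignment m d → Set} → (∀ ρ → Dec (P ρ)) → Vec (Fin (suc m)) d → Bool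
  decide P? v = does (P? (Vec.lookup v))

  T-decide : ∀ {m} {P : Assignment m d → Set} (P? : ∀ ρ → Dec (P ρ)) → P Respects _≗_ → ∀ ρ → T (decide P? (tabulate ρ)) ⇔ P ρ
  T-decide P? P-resp ρ = respects⇒⇔ P-resp (lookup∘tabulate ρ) ∘⇔ T-does (P? _)

  module _ {m} (p : Picture k s m) (I′ : Interp m Γ′) where

    Sat-slot : ∀ ρ i σ → Sat p I′ ρ (slot i σ) ⇔ Holds (slotValue I′) i (evalT ρ ∘ σ)
    Sat-slot ρ i σ = go (i <? N)
      where
      go : (i<N? : Dec (i < N)) → Sat p I′ ρ (slotᵈ i<N? σ) ⇔ T (slotValueᵈ I′ i<N? (tabulate (evalT ρ ∘ σ)))
      go (yes i<N) = ⇔-subst (T ∘ I′ (slotIndex i<N))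
                       (trans (map-cast (evalT ρ) _ (tabulate σ)) (cong (Vec.cast _) (sym (tabulate-∘ (evalT ρ) σ))))
      go (no _)    = mk⇔ (λ ¬⊤ → ¬⊤ refl) (λ ())

    ⇒′-elim : ∀ {ρ} φ ψ → Sat p I′ ρ (φ ⇒′ ψ) → Sat p I′ ρ φ → Sat p I′ ρ ψ
    ⇒′-elim φ ψ (inj₁ ¬φ) φ-holds = ⊥-elim (¬φ φ-holds)
    ⇒′-elim φ ψ (inj₂ ψ-holds) _  = ψ-holds

    ⇒′-intro : ∀ {ρ} φ ψ → (Sat p I′ ρ φ → Sat p I′ ρ ψ) → Sat p I′ ρ (φ ⇒′ ψ)
    ⇒′-intro {ρ} φ ψ φ→ψ with Sat? p I′ ρ φ
    ... | yes φ-holds = inj₂ (φ→ψ φ-holds)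
    ... | no  ¬φ      = inj₁ ¬φ

    ⇔′-elim : ∀ {ρ} φ ψ → Sat p I′ ρ (φ ⇔′ ψ) → Sat p I′ ρ φ ⇔ Sat p I′ ρ ψ
    ⇔′-elim φ ψ (φ→ψ , ψ→φ) = mk⇔ (⇒′-elim φ ψ φ→ψ) (⇒′-elim ψ φ ψ→φ)

    ⇔′-intro : ∀ {ρ} φ ψ → Sat p I′ ρ φ ⇔ Sat p I′ ρ ψ → Sat p I′ ρ (φ ⇔′ ψ)
    ⇔′-intro φ ψ φ⇔ψ = ⇒′-intro φ ψ (Equivalence.to φ⇔ψ) , ⇒′-intro ψ φ (Equivalence.from φ⇔ψ)

    ⋀-elim : ∀ {A : Set} {ρ} (f : A → Formula′) as → Sat p I′ ρ (⋀ (List.map f as)) → ∀ {a} → a ∈ as → Sat p I′ ρ (f a)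
    ⋀-elim f (a List.∷ as) (fa , _)   (here refl) = fa
    ⋀-elim f (a List.∷ as) (_ , fas) (there a∈as) = ⋀-elim f as fas a∈as

    ⋀-intro : ∀ {A : Set} {ρ} (f : A → Formula′) as → (∀ {a} → a ∈ as → Sat p I′ ρ (f a)) → Sat p I′ ρ (⋀ (List.map f as))
    ⋀-intro f List.[]       _   = refl
    ⋀-intro f (a List.∷ as) fas = fas (here refl) , ⋀-intro f as (fas ∘ there)

  qf-slot : ∀ i σ → QuantifierFree (slot i σ)
  qf-slot i σ with i <? N
  ... | yes _ = rel _ _
  ... | no _  = neg (eq _ _)

  qf-⇒′ : ∀ {φ ψ} → QuantifierFree φ → QuantifierFree ψ → QuantifierFree (φ ⇒′ ψ)
  qf-⇒′ qφ qψ = disj (neg qφ) qψ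

  qf-⇔′ : ∀ {φ ψ} → QuantifierFree φ → QuantifierFree ψ → QuantifierFree (φ ⇔′ ψ)
  qf-⇔′ qφ qψ = conj (qf-⇒′ qφ qψ) (qf-⇒′ qψ qφ)

  qf-⋀ : ∀ {A : Set} {f : A → Formula′} → (∀ a → QuantifierFree (f a)) → ∀ as → QuantifierFree (⋀ (List.map f as))
  qf-⋀ qf List.[]       = eq _ _
  qf-⋀ qf (a List.∷ as) = conj (qf a) (qf-⋀ qf as)

  module RunningAxioms (x : Fin d) {θ : Formula′} (qθ : QuantifierFree θ) (S E : ℕ) where

    S₀ S₊ E₀ E₊ θ₊ : Formula′
    S₀ = slot S var
    S₊ = slot S (next x)
    E₀ = slot E var
    E₊ = slot E (next x)
    θ₊ = subF qθ (next x)

    runningAxioms : Formula′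
    runningAxioms =  (isMin (var x) ⇒′ (S₀ ⇔′ θ))
                  ∧′ ((¬ᶠ isMax (var x)) ⇒′ (S₊ ⇔′ (S₀ ∨ᶠ θ₊)))
                  ∧′ (isMax (var x) ⇒′ (E₀ ⇔′ S₀))
                  ∧′ (E₀ ⇒′ E₊)

  open RunningAxioms public using (runningAxioms)

  qf-runningAxioms : ∀ x {θ} (qθ : QuantifierFree θ) S E → QuantifierFree (runningAxioms x qθ S E)
  qf-runningAxioms x qθ S E =
    conj (qf-⇒′ (isMin _) (qf-⇔′ (qf-slot _ _) qθ))
    (conj (qf-⇒′ (neg (isMax _)) (qf-⇔′ (qf-slot _ _) (disj (qf-slot _ _) (subF-qf qθ _))))
    (conj (qf-⇒′ (isMax _) (qf-⇔′ (qf-slot _ _) (qf-slot _ _))) (qf-⇒′ (qf-slot _ _) (qf-slot _ _))))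

  module _ {m} (p : Picture k s m) (I′ : Interp m Γ′) (x : Fin d) {θ : Formula′} (qθ : QuantifierFree θ) (S E : ℕ)
           {Th : Assignment m d → Set} (θ⇔Th : ∀ ρ → Sat p I′ ρ θ ⇔ Th ρ) where

    open RunningAxioms x qθ S E hiding (runningAxioms)

    private
      J = slotValue I′

      S₀⇔ : ∀ ρ → Sat p I′ ρ S₀ ⇔ Holds J S ρ
      S₀⇔ ρ = Sat-slot p I′ ρ S var

      E₀⇔ : ∀ ρ → Sat p I′ ρ E₀ ⇔ Holds J E ρ
      E₀⇔ ρ = Sat-slot p I′ ρ E var

      slot-next : ∀ ρ i → Sat p I′ ρ (slot i (next x)) ⇔ Holds J i (incr x ρ)
      slot-next ρ i = Holds-cong J i (evalT-next ρ x) ∘⇔ Sat-slot p I′ ρ i (next x)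

      θ₊⇔ : ∀ ρ → Sat p I′ ρ θ₊ ⇔ Th (incr x ρ)
      θ₊⇔ ρ = θ⇔Th (incr x ρ) ∘⇔ Sat-cong p I′ θ (evalT-next ρ x) ∘⇔ Sat-subF p I′ ρ (next x) qθ

    axioms⇒running : (∀ ρ → Sat p I′ ρ (runningAxioms x qθ S E)) → IsRunningExists x Th (Holds J S) (Holds J E)
    axioms⇒running axioms = record
      { S-resp = Holds-resp J S
      ; E-resp = Holds-resp J E
      ; start  = λ ρ ρx≡0 → θ⇔Th ρ ∘⇔ start ρ ρx≡0 ∘⇔ ⇔-sym (S₀⇔ ρ)
      ; step   = λ ρ ρx≢m → (S₀⇔ ρ ⊎-⇔ θ₊⇔ ρ) ∘⇔ step ρ ρx≢m ∘⇔ ⇔-sym (slot-next ρ S)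
      ; finish = λ ρ ρx≡m → S₀⇔ ρ ∘⇔ finish ρ ρx≡m ∘⇔ ⇔-sym (E₀⇔ ρ)
      ; shift  = λ ρ → Equivalence.to (slot-next ρ E) ∘ shift ρ ∘ Equivalence.from (E₀⇔ ρ)
      }
      where
      start : ∀ ρ → toℕ (ρ x) ≡ 0 → Sat p I′ ρ S₀ ⇔ Sat p I′ ρ θ
      start ρ = ⇔′-elim p I′ S₀ θ ∘ ⇒′-elim p I′ (isMin (var x)) (S₀ ⇔′ θ) (proj₁ (axioms ρ))
      step : ∀ ρ → toℕ (ρ x) ≢ m → Sat p I′ ρ S₊ ⇔ Sat p I′ ρ (S₀ ∨ᶠ θ₊)
      step ρ = ⇔′-elim p I′ S₊ (S₀ ∨ᶠ θ₊)
             ∘ ⇒′-elim p I′ (¬ᶠ isMax (var x)) (S₊ ⇔′ (S₀ ∨ᶠ θ₊)) (proj₁ (proj₂ (axioms ρ)))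
      finish : ∀ ρ → toℕ (ρ x) ≡ m → Sat p I′ ρ E₀ ⇔ Sat p I′ ρ S₀
      finish ρ = ⇔′-elim p I′ E₀ S₀ ∘ ⇒′-elim p I′ (isMax (var x)) (E₀ ⇔′ S₀) (proj₁ (proj₂ (proj₂ (axioms ρ))))
      shift : ∀ ρ → Sat p I′ ρ E₀ → Sat p I′ ρ E₊
      shift ρ = ⇒′-elim p I′ E₀ E₊ (proj₂ (proj₂ (proj₂ (axioms ρ))))

    running⇒axioms : IsRunningExists x Th (Holds J S) (Holds J E) → ∀ ρ → Sat p I′ ρ (runningAxioms x qθ S E)
    running⇒axioms running ρ =
        ⇒′-intro p I′ (isMin (var x)) (S₀ ⇔′ θ)
          (λ ρx≡0 → ⇔′-intro p I′ S₀ θ (⇔-sym (θ⇔Th ρ) ∘⇔ start ρ ρx≡0 ∘⇔ S₀⇔ ρ))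
      , ⇒′-intro p I′ (¬ᶠ isMax (var x)) (S₊ ⇔′ (S₀ ∨ᶠ θ₊))
          (λ ρx≢m → ⇔′-intro p I′ S₊ (S₀ ∨ᶠ θ₊)
                      (⇔-sym (S₀⇔ ρ ⊎-⇔ θ₊⇔ ρ) ∘⇔ step ρ ρx≢m ∘⇔ slot-next ρ S))
      , ⇒′-intro p I′ (isMax (var x)) (E₀ ⇔′ S₀)
          (λ ρx≡m → ⇔′-intro p I′ E₀ S₀ (⇔-sym (S₀⇔ ρ) ∘⇔ finish ρ ρx≡m ∘⇔ E₀⇔ ρ))
      , ⇒′-intro p I′ E₀ E₊ (Equivalence.from (slot-next ρ E) ∘ shift ρ ∘ Equivalence.to (E₀⇔ ρ))
      where open IsRunningExists running

  slot⇔∃ : ∀ {m} (p : Picture k s m) (I′ : Interp m Γ′) x {θ : Formula′} (qθ : QuantifierFree θ) S E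
               {Th : Assignment m d → Set} → Th Respects _≗_ → (∀ ρ → Sat p I′ ρ θ ⇔ Th ρ) →
               (∀ ρ → Sat p I′ ρ (runningAxioms x qθ S E)) →
               ∀ ρ → Sat p I′ ρ (slot E var) ⇔ (∃ λ a → Th (update ρ x a))
  slot⇔∃ p I′ x qθ S E {Th} Th-resp θ⇔Th axioms ρ =
    RunningExists.running⇒exists x Th Th-resp (axioms⇒running p I′ x qθ S E θ⇔Th axioms) ρ ∘⇔ Sat-slot p I′ ρ E var

slotCount : ∀ {k s d Γ} → Formula k s d Γ → ℕ
slotCount (rel j ts) = 1
slotCount (¬ᶠ φ)     = slotCount φ
slotCount (φ ∧ᶠ ψ)   = slotCount φ + slotCount ψ
slotCount (φ ∨ᶠ ψ)   = slotCount φ + slotCount ψ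
slotCount (∀ᶠ x φ)   = 2 + slotCount φ
slotCount (∃ᶠ x φ)   = 2 + slotCount φ
slotCount _          = 0

-- A subformula whose first slot is b owns the slots b, …, b + slotCount φ - 1: an atom R_j(t̄)
-- owns b, a binary connective gives its right operand the slots after those of its left one,
-- and Qx φ owns, after the slots of φ, the running slot S and the ∃x-slot E.
module Translation {k s d : ℕ} (x₀ : Fin d) (Γ : List ℕ) (N : ℕ) where
  open Slots {k} {s} x₀ N public

  Formulaᴳ : Set
  Formulaᴳ = Formula k s d Γ

  runningSlot existsSlot : ℕ → Formulaᴳ → ℕ
  runningSlot b φ = b + slotCount φ
  existsSlot b φ = suc (b + slotCount φ)

  translate : ℕ → Formulaᴳ → Formula′
  translate b (pic c ts) = pic c ts
  translate b (rel j ts) = slot b var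
  translate b (t ≐ u)    = t ≐ u
  translate b (t ≺ u)    = t ≺ u
  translate b (isMin t)  = isMin t
  translate b (isMax t)  = isMax t
  translate b (¬ᶠ φ)     = ¬ᶠ translate b φ
  translate b (φ ∧ᶠ ψ)   = translate b φ ∧ᶠ translate (b + slotCount φ) ψ
  translate b (φ ∨ᶠ ψ)   = translate b φ ∨ᶠ translate (b + slotCount φ) ψ
  translate b (∀ᶠ x φ)   = ¬ᶠ slot (existsSlot b φ) var
  translate b (∃ᶠ x φ)   = slot (existsSlot b φ) var

  qf-translate : ∀ b φ → QuantifierFree (translate b φ)
  qf-translate b (pic c ts) = pic c ts
  qf-translate b (rel j ts) = qf-slot _ _
  qf-translate b (t ≐ u)    = eq t u
  qf-translate b (t ≺ u)    = lt t u
  qf-translate b (isMin t)  = isMin t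
  qf-translate b (isMax t)  = isMax t
  qf-translate b (¬ᶠ φ)     = neg (qf-translate b φ)
  qf-translate b (φ ∧ᶠ ψ)   = conj (qf-translate b φ) (qf-translate _ ψ)
  qf-translate b (φ ∨ᶠ ψ)   = disj (qf-translate b φ) (qf-translate _ ψ)
  qf-translate b (∀ᶠ x φ)   = neg (qf-slot _ _)
  qf-translate b (∃ᶠ x φ)   = qf-slot _ _

  -- ∀x φ is read as ¬∃x¬φ.
  quantifierAxioms : ℕ → Formulaᴳ → Formula′
  quantifierAxioms b (¬ᶠ φ)   = quantifierAxioms b φ
  quantifierAxioms b (φ ∧ᶠ ψ) = quantifierAxioms b φ ∧′ quantifierAxioms (b + slotCount φ) ψ
  quantifierAxioms b (φ ∨ᶠ ψ) = quantifierAxioms b φ ∧′ quantifierAxioms (b + slotCount φ) ψ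
  quantifierAxioms b (∀ᶠ x φ) = quantifierAxioms b φ ∧′ runningAxioms x (neg (qf-translate b φ)) (runningSlot b φ) (existsSlot b φ)
  quantifierAxioms b (∃ᶠ x φ) = quantifierAxioms b φ ∧′ runningAxioms x (qf-translate b φ) (runningSlot b φ) (existsSlot b φ)
  quantifierAxioms b _        = ⊤′

  qf-quantifierAxioms : ∀ b φ → QuantifierFree (quantifierAxioms b φ)
  qf-quantifierAxioms b (pic c ts) = eq _ _
  qf-quantifierAxioms b (rel j ts) = eq _ _
  qf-quantifierAxioms b (t ≐ u)    = eq _ _
  qf-quantifierAxioms b (t ≺ u)    = eq _ _
  qf-quantifierAxioms b (isMin t)  = eq _ _
  qf-quantifierAxioms b (isMax t)  = eq _ _
  qf-quantifierAxioms b (¬ᶠ φ)     = qf-quantifierAxioms b φ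
  qf-quantifierAxioms b (φ ∧ᶠ ψ)   = conj (qf-quantifierAxioms b φ) (qf-quantifierAxioms _ ψ)
  qf-quantifierAxioms b (φ ∨ᶠ ψ)   = conj (qf-quantifierAxioms b φ) (qf-quantifierAxioms _ ψ)
  qf-quantifierAxioms b (∀ᶠ x φ)   = conj (qf-quantifierAxioms b φ) (qf-runningAxioms x _ _ _)
  qf-quantifierAxioms b (∃ᶠ x φ)   = conj (qf-quantifierAxioms b φ) (qf-runningAxioms x _ _ _)

  -- The argument terms and the slot of an occurrence of R_j.
  Occurrence : Fin (length Γ) → Set
  Occurrence j = Vec (Term d) (lookup Γ j) × ℕ

  occurrences : ∀ j → ℕ → Formulaᴳ → List (Occurrence j)
  occurrences j b (rel j′ ts) with j′ Fin.≟ j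
  ... | yes refl = (ts , b) List.∷ List.[]
  ... | no _     = List.[]
  occurrences j b (¬ᶠ φ)   = occurrences j b φ
  occurrences j b (φ ∧ᶠ ψ) = occurrences j b φ ++ occurrences j (b + slotCount φ) ψ
  occurrences j b (φ ∨ᶠ ψ) = occurrences j b φ ++ occurrences j (b + slotCount φ) ψ
  occurrences j b (∀ᶠ x φ) = occurrences j b φ
  occurrences j b (∃ᶠ x φ) = occurrences j b φ
  occurrences j b _        = List.[]

  occurrences-rel : ∀ j b ts → (ts , b) ∈ occurrences j b (rel j ts)
  occurrences-rel j b ts with j Fin.≟ j
  ... | yes refl = here refl
  ... | no j≢j   = ⊥-elim (j≢j refl)

  transferGuard : ∀ {r} (t u : Vec (Term d) r) → Formula′
  transferGuard {r} t u = ⋀ (List.map (λ i → subT α (Vec.lookup t i) ≐ subT β (Vec.lookup u i)) (List.allFin r))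
    where open Transfer t u

  transferAxiom : ∀ {j} → Occurrence j → Occurrence j → Formula′
  transferAxiom (t , i₁) (u , i₂) = transferGuard t u ⇒′ (slot i₁ α ⇒′ slot i₂ β)
    where open Transfer t u

  freeAxiomᵈ : ∀ {j} (w : Occurrence j) y → Dec (Any (RootedAt y) (proj₁ w)) → Formula′
  freeAxiomᵈ (u , i) y (yes _) = ⊤′
  freeAxiomᵈ (u , i) y (no _)  = slot i var ⇒′ slot i (next y)

  freeAxiom : ∀ {j} → Occurrence j → Fin d → Formula′
  freeAxiom w y = freeAxiomᵈ w y (occurs? (proj₁ w) y)

  occurrenceAxioms : ∀ {j} → List (Occurrence j) → Occurrence j → Formula′
  occurrenceAxioms O w = ⋀ (List.map (transferAxiom w) O) ∧′ ⋀ (List.map (freeAxiom w) (List.allFin d))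

  consistencyAxioms : Formulaᴳ → Formula′
  consistencyAxioms φ = ⋀ (List.map (λ j → ⋀ (List.map (occurrenceAxioms (O j)) (O j))) (List.allFin (length Γ)))
    where O = λ j → occurrences j 0 φ

  qf-transferAxiom : ∀ {j} (w w′ : Occurrence j) → QuantifierFree (transferAxiom w w′)
  qf-transferAxiom (t , _) (u , _) = qf-⇒′ (qf-⋀ (λ _ → eq _ _) (List.allFin _)) (qf-⇒′ (qf-slot _ _) (qf-slot _ _))

  qf-freeAxiom : ∀ {j} (w : Occurrence j) y → QuantifierFree (freeAxiom w y)
  qf-freeAxiom (u , i) y with occurs? u y
  ... | yes _ = eq _ _
  ... | no _  = qf-⇒′ (qf-slot _ _) (qf-slot _ _)

  qf-consistencyAxioms : ∀ φ → QuantifierFree (consistencyAxioms φ)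
  qf-consistencyAxioms φ =
    qf-⋀ (λ j → qf-⋀ (λ w → conj (qf-⋀ (qf-transferAxiom w) _) (qf-⋀ (qf-freeAxiom w) _)) _) _

  translation : Formulaᴳ → Formula′
  translation φ = translate 0 φ ∧′ quantifierAxioms 0 φ ∧′ consistencyAxioms φ

  qf-translation : ∀ φ → QuantifierFree (translation φ)
  qf-translation φ = conj (qf-translate 0 φ) (conj (qf-quantifierAxioms 0 φ) (qf-consistencyAxioms φ))

  module _ {m} (p : Picture k s m) (I′ : Interp m Γ′) where

    freeAxiom-elim : ∀ {j u i y ρ} → Sat p I′ ρ (freeAxiom {j} (u , i) y) → ¬ Any (RootedAt y) u →
                     Sat p I′ ρ (slot i var ⇒′ slot i (next y))
    freeAxiom-elim {u = u} {y = y} axiom y∉u with occurs? u y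
    ... | yes y∈u = ⊥-elim (y∉u y∈u)
    ... | no _    = axiom

    freeAxiom-intro : ∀ {j u i y ρ} → (¬ Any (RootedAt y) u → Sat p I′ ρ (slot i var ⇒′ slot i (next y))) →
                      Sat p I′ ρ (freeAxiom {j} (u , i) y)
    freeAxiom-intro {u = u} {y = y} axiom with occurs? u y
    ... | yes _   = refl
    ... | no y∉u  = axiom y∉u

    module _ {r} (t u : Vec (Term d) r) (c : Assignment m d) where
      open Transfer t u

      transferGuard-intro : (∀ i → evalT (evalT c ∘ α) (Vec.lookup t i) ≡ evalT (evalT c ∘ β) (Vec.lookup u i)) →
                            Sat p I′ c (transferGuard t u)
      transferGuard-intro t≡u = ⋀-intro p I′ _ (List.allFin r)
        (λ {i} _ → trans (evalT-subT c α (Vec.lookup t i)) (trans (t≡u i) (sym (evalT-subT c β (Vec.lookup u i)))))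

      transferGuard-elim : Sat p I′ c (transferGuard t u) → map (evalT (evalT c ∘ α)) t ≡ map (evalT (evalT c ∘ β)) u
      transferGuard-elim guard = vec-ext λ i → begin
        Vec.lookup (map (evalT (evalT c ∘ α)) t) i ≡⟨ lookup-map i _ t ⟩
        evalT (evalT c ∘ α) (Vec.lookup t i)       ≡⟨ evalT-subT c α (Vec.lookup t i) ⟨
        evalT c (subT α (Vec.lookup t i))
          ≡⟨ ⋀-elim p I′ (λ i → subT α (Vec.lookup t i) ≐ subT β (Vec.lookup u i)) _ guard (∈-allFin i) ⟩
        evalT c (subT β (Vec.lookup u i))          ≡⟨ evalT-subT c β (Vec.lookup u i) ⟩
        evalT (evalT c ∘ β) (Vec.lookup u i)       ≡⟨ lookup-map i _ u ⟨
        Vec.lookup (map (evalT (evalT c ∘ β)) u) i ∎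
        where open ≡-Reasoning

  module _ {m} (p : Picture k s m) (I′ : Interp m Γ′) (I : Interp m Γ) where

    AtomsCorrect : ℕ → Formulaᴳ → Set
    AtomsCorrect b φ = ∀ j {w} → w ∈ occurrences j b φ →
                       ∀ ρ → Holds (slotValue I′) (proj₂ w) ρ ⇔ T (I j (map (evalT ρ) (proj₁ w)))

    translate-correct : ∀ b φ → AtomsCorrect b φ → (∀ ρ → Sat p I′ ρ (quantifierAxioms b φ)) →
                        ∀ ρ → Sat p I′ ρ (translate b φ) ⇔ Sat p I ρ φ
    translate-correct b (pic c ts) atoms axioms ρ = ⇔-id _
    translate-correct b (rel j ts) atoms axioms ρ = atoms j (occurrences-rel j b ts) ρ ∘⇔ Sat-slot p I′ ρ b var
    translate-correct b (t ≐ u)    atoms axioms ρ = ⇔-id _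
    translate-correct b (t ≺ u)    atoms axioms ρ = ⇔-id _
    translate-correct b (isMin t)  atoms axioms ρ = ⇔-id _
    translate-correct b (isMax t)  atoms axioms ρ = ⇔-id _
    translate-correct b (¬ᶠ φ)     atoms axioms ρ = ¬-cong-⇔ (translate-correct b φ atoms axioms ρ)
    translate-correct b (φ ∧ᶠ ψ)   atoms axioms ρ =
      translate-correct b φ (λ j → atoms j ∘ ∈-++⁺ˡ) (proj₁ ∘ axioms) ρ
      ×-⇔ translate-correct _ ψ (λ j → atoms j ∘ ∈-++⁺ʳ (occurrences j b φ)) (proj₂ ∘ axioms) ρ
    translate-correct b (φ ∨ᶠ ψ)   atoms axioms ρ =
      translate-correct b φ (λ j → atoms j ∘ ∈-++⁺ˡ) (proj₁ ∘ axioms) ρ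
      ⊎-⇔ translate-correct _ ψ (λ j → atoms j ∘ ∈-++⁺ʳ (occurrences j b φ)) (proj₂ ∘ axioms) ρ
    translate-correct b (∀ᶠ x φ)   atoms axioms ρ =
      ¬∃¬⇔∀ (λ a → Sat? p I (update ρ x a) φ)
      ∘⇔ ¬-cong-⇔ (slot⇔∃ p I′ x (neg (qf-translate b φ)) (runningSlot b φ) (existsSlot b φ) (¬Sat-resp p I φ)
                     (¬-cong-⇔ ∘ translate-correct b φ atoms (proj₁ ∘ axioms)) (proj₂ ∘ axioms) ρ)
    translate-correct b (∃ᶠ x φ)   atoms axioms ρ =
      slot⇔∃ p I′ x (qf-translate b φ) (runningSlot b φ) (existsSlot b φ) (Sat-resp p I φ)
        (translate-correct b φ atoms (proj₁ ∘ axioms)) (proj₂ ∘ axioms) ρ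


    atoms⇒consistency : ∀ φ → AtomsCorrect 0 φ → ∀ ρ → Sat p I′ ρ (consistencyAxioms φ)
    atoms⇒consistency φ atoms ρ =
      ⋀-intro p I′ _ (List.allFin (length Γ)) λ {j} _ →
        ⋀-intro p I′ (occurrenceAxioms (O j)) (O j) λ {w} w∈O →
          ⋀-intro p I′ (transferAxiom w) (O j) (transfer w∈O) , ⋀-intro p I′ (freeAxiom w) (List.allFin d) (λ {y} _ → free w∈O y)
      where
      open Equivalence using (to; from)
      O = λ j → occurrences j 0 φ

      transfer : ∀ {j t i₁ u i₂} → (t , i₁) ∈ O j → (u , i₂) ∈ O j → Sat p I′ ρ (transferAxiom (t , i₁) (u , i₂))
      transfer {j} {t} {i₁} {u} {i₂} t∈O u∈O =
        ⇒′-intro p I′ (transferGuard t u) (slot i₁ α ⇒′ slot i₂ β) λ guard →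
        ⇒′-intro p I′ (slot i₁ α) (slot i₂ β) λ holds₁ →
          from (Sat-slot p I′ ρ i₂ β) (from (atoms j u∈O (evalT ρ ∘ β))
            (subst (T ∘ I j) (transferGuard-elim p I′ t u ρ guard)
              (to (atoms j t∈O (evalT ρ ∘ α)) (to (Sat-slot p I′ ρ i₁ α) holds₁))))
        where open Transfer t u

      free : ∀ {j u i} → (u , i) ∈ O j → ∀ y → Sat p I′ ρ (freeAxiom (u , i) y)
      free {j} {u} {i} u∈O y = freeAxiom-intro p I′ λ y∉u → ⇒′-intro p I′ (slot i var) (slot i (next y)) λ holds →
        from (Holds-cong (slotValue I′) i (evalT-next ρ y) ∘⇔ Sat-slot p I′ ρ i (next y)) (from (atoms j u∈O (incr y ρ))
          (subst (T ∘ I j) (sym (map-evalT-update-free u y∉u ρ _)) (to (atoms j u∈O ρ) (to (Sat-slot p I′ ρ i var) holds))))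

-- From a model of the translation, R_j is read off the slots of its occurrences:
-- τ ∈ R_j iff some occurrence R_j(t̄) with slot i has t̄(v) = τ for an assignment v in slot i.
module Soundness {k s d : ℕ} (x₀ : Fin d) (Γ : List ℕ) (N : ℕ) {m : ℕ} (p : Picture k s m)
                 (I′ : Interp m (Slots.Γ′ {k} {s} x₀ N)) (body : Formula k s d Γ)
                 (models : ∀ ρ → Sat p I′ ρ (Translation.translation {k} {s} x₀ Γ N body)) where
  open Translation {k} {s} x₀ Γ N

  private
    J = slotValue I′
    O = λ j → occurrences j 0 body

  Witness : ∀ j → Vec (Fin (suc m)) (lookup Γ j) → Occurrence j → Set
  Witness j τ (u , i) = ∃ λ v → map (evalT (Vec.lookup v)) u ≡ τ × Holds J i (Vec.lookup v)

  witness? : ∀ j τ w → Dec (Witness j τ w)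
  witness? j τ (u , i) = ∃-Vec? d (λ v → ≡-dec Fin._≟_ (map (evalT (Vec.lookup v)) u) τ ×-dec T? (J i (tabulate (Vec.lookup v))))

  I° : Interp m Γ
  I° j τ = does (AnyL.any? (witness? j τ) (O j))

  occurrenceAxioms-holds : ∀ {j w} → w ∈ O j → ∀ ρ → Sat p I′ ρ (occurrenceAxioms (O j) w)
  occurrenceAxioms-holds {j} w∈O ρ =
    ⋀-elim p I′ (occurrenceAxioms (O j)) (O j) (⋀-elim p I′ _ (List.allFin (length Γ)) (proj₂ (proj₂ (models ρ))) (∈-allFin j)) w∈O

  free-holds : ∀ {j u i} → (u , i) ∈ O j → ∀ y → ¬ Any (RootedAt y) u → ∀ ρ → Holds J i ρ → Holds J i (incr y ρ)
  free-holds {u = u} {i} w∈O y y∉u ρ =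
    Equivalence.to (Holds-cong J i (evalT-next ρ y) ∘⇔ Sat-slot p I′ ρ i (next y))
    ∘ ⇒′-elim p I′ (slot i var) (slot i (next y))
        (freeAxiom-elim p I′ (⋀-elim p I′ (freeAxiom (u , i)) _ (proj₂ (occurrenceAxioms-holds w∈O ρ)) (∈-allFin y)) y∉u)
    ∘ Equivalence.from (Sat-slot p I′ ρ i var)

  transfer-holds : ∀ {j t i₁ u i₂} → (t , i₁) ∈ O j → (u , i₂) ∈ O j → ∀ c →
                   (∀ i → evalT (evalT c ∘ Transfer.α t u) (Vec.lookup t i) ≡ evalT (evalT c ∘ Transfer.β t u) (Vec.lookup u i)) →
                   Holds J i₁ (evalT c ∘ Transfer.α t u) → Holds J i₂ (evalT c ∘ Transfer.β t u)
  transfer-holds {j} {t} {i₁} {u} {i₂} t∈O u∈O c t≡u =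
    Equivalence.to (Sat-slot p I′ c i₂ β)
    ∘ ⇒′-elim p I′ (slot i₁ α) (slot i₂ β)
        (⇒′-elim p I′ (transferGuard t u) (slot i₁ α ⇒′ slot i₂ β)
                 (⋀-elim p I′ (transferAxiom (t , i₁)) (O j) (proj₁ (occurrenceAxioms-holds t∈O c)) u∈O)
                 (transferGuard-intro p I′ t u c t≡u))
    ∘ Equivalence.from (Sat-slot p I′ c i₁ α)
    where open Transfer t u

  atoms-correct : AtomsCorrect p I′ I° 0 body
  atoms-correct j {u , i₂} u∈O ρ = ⇔-sym (T-does (AnyL.any? (witness? j _) (O j))) ∘⇔ mk⇔ to from
    where
    to : Holds J i₂ ρ → AnyL.Any (Witness j (map (evalT ρ) u)) (O j)
    to holds = loseL u∈O (tabulate ρ , map-cong (evalT-cong (lookup∘tabulate ρ)) u , Holds-resp J i₂ (sym ∘ lookup∘tabulate ρ) holds)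
    from : AnyL.Any (Witness j (map (evalT ρ) u)) (O j) → Holds J i₂ ρ
    from witnessed with find witnessed
    ... | (t , i₁) , t∈O , v , t[v]≡u[ρ] , holds =
      Transfer.transfer t u (Holds-resp J i₂) (Holds-resp J i₁) (transfer-holds t∈O u∈O) (λ y y∉u → free-holds u∈O y y∉u)
        (Vec.lookup v) ρ t[v]≡u[ρ] holds

  soundness : ∀ ρ → Sat p I° ρ body
  soundness ρ = Equivalence.to (translate-correct p I′ I° 0 body atoms-correct (proj₁ ∘ proj₂ ∘ models) ρ) (proj₁ (models ρ))

module Completeness {k s d : ℕ} (x₀ : Fin d) (Γ : List ℕ) (N : ℕ) {m : ℕ} (p : Picture k s m) (I : Interp m Γ) where
  open Translation {k} {s} x₀ Γ N

  Canonical : SlotInterp m → ℕ → Formulaᴳ → Set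
  Canonical J b (rel j ts) = ∀ ρ → Holds J b ρ ⇔ T (I j (map (evalT ρ) ts))
  Canonical J b (¬ᶠ φ)     = Canonical J b φ
  Canonical J b (φ ∧ᶠ ψ)   = Canonical J b φ × Canonical J (b + slotCount φ) ψ
  Canonical J b (φ ∨ᶠ ψ)   = Canonical J b φ × Canonical J (b + slotCount φ) ψ
  Canonical J b (∀ᶠ x φ)   = Canonical J b φ × IsRunningExists x (λ ρ → ¬ Sat p I ρ φ) (Holds J (runningSlot b φ)) (Holds J (existsSlot b φ))
  Canonical J b (∃ᶠ x φ)   = Canonical J b φ × IsRunningExists x (λ ρ → Sat p I ρ φ) (Holds J (runningSlot b φ)) (Holds J (existsSlot b φ))
  Canonical J b _          = ⊤

  AgreeBetween : SlotInterp m → SlotInterp m → ℕ → ℕ → Set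
  AgreeBetween J J′ b c = ∀ i → b ≤ i → i < c → J i ≗ J′ i

  agreeBetween-⊆ : ∀ {J J′ b c b′ c′} → b ≤ b′ → c′ ≤ c → AgreeBetween J J′ b c → AgreeBetween J J′ b′ c′
  agreeBetween-⊆ b≤b′ c′≤c agree i b′≤i i<c′ = agree i (ℕ.≤-trans b≤b′ b′≤i) (ℕ.<-≤-trans i<c′ c′≤c)

  module _ (b n : ℕ) where
    body⊆ : b + n ≤ b + (2 + n)
    body⊆ = ℕ.+-monoʳ-≤ b (ℕ.m≤n+m n 2)
    running∈ : b + n < b + (2 + n)
    running∈ = ℕ.+-monoʳ-< b (ℕ.m<n+m n z<s)
    exists∈ : suc (b + n) < b + (2 + n)
    exists∈ = ℕ.<-≤-trans (ℕ.n<1+n _) (ℕ.≤-reflexive (sym (trans (ℕ.+-suc b (suc n)) (cong suc (ℕ.+-suc b n)))))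

  canonical-agree : ∀ {J J′} b φ → AgreeBetween J J′ b (b + slotCount φ) → Canonical J b φ → Canonical J′ b φ
  canonical-agree-split : ∀ {J J′} b φ ψ → AgreeBetween J J′ b (b + (slotCount φ + slotCount ψ)) →
                          Canonical J b φ × Canonical J (b + slotCount φ) ψ → Canonical J′ b φ × Canonical J′ (b + slotCount φ) ψ
  canonical-agree-split b φ ψ agree (canonφ , canonψ) =
      canonical-agree b φ (agreeBetween-⊆ ℕ.≤-refl (ℕ.+-monoʳ-≤ b (ℕ.m≤m+n _ _)) agree) canonφ
    , canonical-agree _ ψ (agreeBetween-⊆ (ℕ.m≤m+n b _) (ℕ.≤-reflexive (ℕ.+-assoc b _ _)) agree) canonψ

  canonical-agree-quantifier : ∀ {J J′} {Th : Assignment m d → Set} {x} b φ → AgreeBetween J J′ b (b + (2 + slotCount φ)) →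
    Canonical J b φ × IsRunningExists x Th (Holds J (runningSlot b φ)) (Holds J (existsSlot b φ)) →
    Canonical J′ b φ × IsRunningExists x Th (Holds J′ (runningSlot b φ)) (Holds J′ (existsSlot b φ))
  canonical-agree-quantifier {J} {J′} b φ agree (canon , running) =
      canonical-agree b φ (agreeBetween-⊆ ℕ.≤-refl (body⊆ b _) agree) canon
    , IsRunningExists-cong (Holds-≗ {J = J} {J′} _ (agree _ (ℕ.m≤m+n b _) (running∈ b _)))
                           (Holds-≗ {J = J} {J′} _ (agree _ (ℕ.m≤n⇒m≤1+n (ℕ.m≤m+n b _)) (exists∈ b _)))
                           running

  canonical-agree b (pic c ts) agree _ = tt
  canonical-agree {J} {J′} b (rel j ts) agree canon ρ =
    canon ρ ∘⇔ Holds-≗ {J = J′} {J} b (sym ∘ agree b ℕ.≤-refl (ℕ.m<m+n b z<s)) ρ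
  canonical-agree b (t ≐ u)    agree _ = tt
  canonical-agree b (t ≺ u)    agree _ = tt
  canonical-agree b (isMin t)  agree _ = tt
  canonical-agree b (isMax t)  agree _ = tt
  canonical-agree b (¬ᶠ φ)     agree canon = canonical-agree b φ agree canon
  canonical-agree b (φ ∧ᶠ ψ)   agree canon = canonical-agree-split b φ ψ agree canon
  canonical-agree b (φ ∨ᶠ ψ)   agree canon = canonical-agree-split b φ ψ agree canon
  canonical-agree b (∀ᶠ x φ)   agree canon = canonical-agree-quantifier b φ agree canon
  canonical-agree b (∃ᶠ x φ)   agree canon = canonical-agree-quantifier b φ agree canon

  pick : ℕ → SlotInterp m → SlotInterp m → SlotInterp m
  pick c J₁ J₂ i with i <? c
  ... | yes _ = J₁ i
  ... | no _  = J₂ i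

  pick-< : ∀ {c} J₁ J₂ {i} → i < c → pick c J₁ J₂ i ≡ J₁ i
  pick-< {c} J₁ J₂ {i} i<c with i <? c
  ... | yes _   = refl
  ... | no  i≮c = ⊥-elim (i≮c i<c)

  pick-≥ : ∀ {c} J₁ J₂ {i} → c ≤ i → pick c J₁ J₂ i ≡ J₂ i
  pick-≥ {c} J₁ J₂ {i} c≤i with i <? c
  ... | yes i<c = ⊥-elim (ℕ.<-irrefl refl (ℕ.<-≤-trans i<c c≤i))
  ... | no  _   = refl

  set : ℕ → (Vec (Fin (suc m)) d → Bool) → SlotInterp m → SlotInterp m
  set c f J i with i ℕ.≟ c
  ... | yes _ = f
  ... | no _  = J i

  set-≡ : ∀ c f J → set c f J c ≡ f
  set-≡ c f J with c ℕ.≟ c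
  ... | yes _   = refl
  ... | no  c≢c = ⊥-elim (c≢c refl)

  set-≢ : ∀ {c} f J {i} → i ≢ c → set c f J i ≡ J i
  set-≢ {c} f J {i} i≢c with i ℕ.≟ c
  ... | yes i≡c = ⊥-elim (i≢c i≡c)
  ... | no  _   = refl

  canonical-split : ∀ b φ ψ → Σ (SlotInterp m) (λ J → Canonical J b φ) → Σ (SlotInterp m) (λ J → Canonical J (b + slotCount φ) ψ) →
                    Σ (SlotInterp m) (λ J → Canonical J b φ × Canonical J (b + slotCount φ) ψ)
  canonical-split b φ ψ (J₁ , canonφ) (J₂ , canonψ) =
      pick (b + slotCount φ) J₁ J₂
    , canonical-agree b φ (λ i _ i<c → cong-app (sym (pick-< J₁ J₂ i<c))) canonφ
    , canonical-agree _ ψ (λ i c≤i _ → cong-app (sym (pick-≥ J₁ J₂ c≤i))) canonψ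

  canonical-quantifier : ∀ x b φ {Th : Assignment m d → Set} (Th-resp : Th Respects _≗_) (Th? : ∀ ρ → Dec (Th ρ)) →
    Σ (SlotInterp m) (λ J → Canonical J b φ) →
    Σ (SlotInterp m) (λ J → Canonical J b φ × IsRunningExists x Th (Holds J (runningSlot b φ)) (Holds J (existsSlot b φ)))
  canonical-quantifier x b φ {Th} Th-resp Th? (J₁ , canon) = J , canonical-agree b φ agree canon , IsRunningExists-cong S⇔ E⇔ running
    where
    open RunningExists x Th Th-resp
    S = runningSlot b φ
    E = existsSlot b φ
    J = set S (decide (Running? Th?)) (set E (decide (Exists? Th?)) J₁)
    agree : AgreeBetween J₁ J b (b + slotCount φ)
    agree i _ i<S = cong-app (sym (trans (set-≢ _ _ (ℕ.<⇒≢ i<S)) (set-≢ _ _ (ℕ.<⇒≢ (ℕ.m<n⇒m<1+n i<S)))))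
    S⇔ : ∀ ρ → Running ρ ⇔ Holds J S ρ
    S⇔ ρ = ⇔-sym (T-decide (Running? Th?) Running-resp ρ ∘⇔ ⇔-subst (λ f → T (f (tabulate ρ))) (set-≡ S (decide (Running? Th?)) _))
    E⇔ : ∀ ρ → Exists ρ ⇔ Holds J E ρ
    E⇔ ρ = ⇔-sym (T-decide (Exists? Th?) Exists-resp ρ
                 ∘⇔ ⇔-subst (λ f → T (f (tabulate ρ)))
                              (trans (set-≢ {S} (decide (Running? Th?)) _ ℕ.1+n≢n) (set-≡ E (decide (Exists? Th?)) J₁)))

  canonical : ∀ b φ → Σ (SlotInterp m) (λ J → Canonical J b φ)
  canonical b (pic c ts) = (λ _ _ → false) , tt
  canonical b (rel j ts) = (λ _ → decide holds?) , T-decide holds? (λ ρ≗ρ′ → subst (T ∘ I j) (map-cong (evalT-cong ρ≗ρ′) ts))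
    where
    holds? : ∀ ρ → Dec (T (I j (map (evalT ρ) ts)))
    holds? ρ = T? (I j (map (evalT ρ) ts))
  canonical b (t ≐ u)    = (λ _ _ → false) , tt
  canonical b (t ≺ u)    = (λ _ _ → false) , tt
  canonical b (isMin t)  = (λ _ _ → false) , tt
  canonical b (isMax t)  = (λ _ _ → false) , tt
  canonical b (¬ᶠ φ)     = canonical b φ
  canonical b (φ ∧ᶠ ψ)   = canonical-split b φ ψ (canonical b φ) (canonical _ ψ)
  canonical b (φ ∨ᶠ ψ)   = canonical-split b φ ψ (canonical b φ) (canonical _ ψ)
  canonical b (∀ᶠ x φ)   = canonical-quantifier x b φ (¬Sat-resp p I φ) (λ ρ → ¬? (Sat? p I ρ φ)) (canonical b φ)
  canonical b (∃ᶠ x φ)   = canonical-quantifier x b φ (Sat-resp p I φ) (λ ρ → Sat? p I ρ φ) (canonical b φ)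

  module _ (I′ : Interp m Γ′) where

    canonical⇒atoms : ∀ b φ → Canonical (slotValue I′) b φ → AtomsCorrect p I′ I b φ
    canonical⇒atoms b (rel j′ ts) canon j w∈occ ρ with j′ Fin.≟ j
    canonical⇒atoms b (rel j′ ts) canon j (here refl) ρ | yes refl = canon ρ
    canonical⇒atoms b (¬ᶠ φ)   canon = canonical⇒atoms b φ canon
    canonical⇒atoms b (φ ∧ᶠ ψ) (canonφ , canonψ) j w∈occ with ∈-++⁻ (occurrences j b φ) w∈occ
    ... | inj₁ w∈φ = canonical⇒atoms b φ canonφ j w∈φ
    ... | inj₂ w∈ψ = canonical⇒atoms _ ψ canonψ j w∈ψ
    canonical⇒atoms b (φ ∨ᶠ ψ) (canonφ , canonψ) j w∈occ with ∈-++⁻ (occurrences j b φ) w∈occ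
    ... | inj₁ w∈φ = canonical⇒atoms b φ canonφ j w∈φ
    ... | inj₂ w∈ψ = canonical⇒atoms _ ψ canonψ j w∈ψ
    canonical⇒atoms b (∀ᶠ x φ) canon = canonical⇒atoms b φ (proj₁ canon)
    canonical⇒atoms b (∃ᶠ x φ) canon = canonical⇒atoms b φ (proj₁ canon)
    canonical⇒atoms b (pic c ts) _ j ()
    canonical⇒atoms b (t ≐ u)    _ j ()
    canonical⇒atoms b (t ≺ u)    _ j ()
    canonical⇒atoms b (isMin t)  _ j ()
    canonical⇒atoms b (isMax t)  _ j ()

    canonical⇒axioms : ∀ b φ → Canonical (slotValue I′) b φ → ∀ ρ → Sat p I′ ρ (quantifierAxioms b φ)
    canonical⇒axioms b (pic c ts) _ ρ = refl
    canonical⇒axioms b (rel j ts) _ ρ = refl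
    canonical⇒axioms b (t ≐ u)    _ ρ = refl
    canonical⇒axioms b (t ≺ u)    _ ρ = refl
    canonical⇒axioms b (isMin t)  _ ρ = refl
    canonical⇒axioms b (isMax t)  _ ρ = refl
    canonical⇒axioms b (¬ᶠ φ)   canon ρ = canonical⇒axioms b φ canon ρ
    canonical⇒axioms b (φ ∧ᶠ ψ) (canonφ , canonψ) ρ = canonical⇒axioms b φ canonφ ρ , canonical⇒axioms _ ψ canonψ ρ
    canonical⇒axioms b (φ ∨ᶠ ψ) (canonφ , canonψ) ρ = canonical⇒axioms b φ canonφ ρ , canonical⇒axioms _ ψ canonψ ρ
    canonical⇒axioms b (∀ᶠ x φ) (canon , running) ρ =
        canonical⇒axioms b φ canon ρ
      , running⇒axioms p I′ x (neg (qf-translate b φ)) (runningSlot b φ) (existsSlot b φ)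
          (¬-cong-⇔ ∘ translate-correct p I′ I b φ (canonical⇒atoms b φ canon) (canonical⇒axioms b φ canon)) running ρ
    canonical⇒axioms b (∃ᶠ x φ) (canon , running) ρ =
        canonical⇒axioms b φ canon ρ
      , running⇒axioms p I′ x (qf-translate b φ) (runningSlot b φ) (existsSlot b φ)
          (translate-correct p I′ I b φ (canonical⇒atoms b φ canon) (canonical⇒axioms b φ canon)) running ρ

  slotModel : Formulaᴳ → Interp m Γ′
  slotModel φ = fromSlots (proj₁ (canonical 0 φ))

  slotModel-canonical : ∀ φ → slotCount φ ≤ N → Canonical (slotValue (slotModel φ)) 0 φ
  slotModel-canonical φ φ≤N = canonical-agree 0 φ
    (λ i _ i<φ → sym ∘ slotValue-fromSlots (proj₁ (canonical 0 φ)) (ℕ.<-≤-trans i<φ φ≤N)) (proj₂ (canonical 0 φ))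

  completeness : ∀ φ → slotCount φ ≤ N → (∀ ρ → Sat p I ρ φ) → ∀ ρ → Sat p (slotModel φ) ρ (translation φ)
  completeness φ φ≤N sat ρ =
      Equivalence.from (translate-correct p I′ I 0 φ atoms axioms ρ) (sat ρ)
    , axioms ρ
    , atoms⇒consistency p I′ I φ atoms ρ
    where
    I′ = slotModel φ
    atoms = canonical⇒atoms I′ 0 φ (slotModel-canonical φ φ≤N)
    axioms = canonical⇒axioms I′ 0 φ (slotModel-canonical φ φ≤N)

proposition4 : (d : ℕ) → 0 < d → (k : ℕ) → 1 ≤ k → (s : ℕ) →
    (Φ : ESOvar k s d) →
    Σ (ESOforall k s d d) λ Φ' →
      (m : ℕ) (p : Picture k s m) → (p ⊨var Φ) ⇔ (p ⊨∀ Φ')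
proposition4 (suc d′) _ k _ s Φ = Φ′ , λ m p → mk⇔ (completeness′ p) (soundness′ p)
  where
  open ESOvar Φ renaming (arities to Γ; body to φ)
  open Translation {k} {s} {suc d′} zero Γ (slotCount φ)

  Φ′ : ESOforall k s (suc d′) (suc d′)
  Φ′ = record { arities = Γ′ ; arityBound = replicate⁺ _ ℕ.≤-refl ; matrix = translation φ ; qf = qf-translation φ }

  completeness′ : ∀ {m} (p : Picture k s m) → p ⊨var Φ → p ⊨∀ Φ′
  completeness′ p (I , sat) =
    slotModel φ , completeness φ ℕ.≤-refl (λ ρ → Sat-closed p I φ closed _ ρ sat)
    where open Completeness zero Γ (slotCount φ) p I

  soundness′ : ∀ {m} (p : Picture k s m) → p ⊨∀ Φ′ → p ⊨var Φ
  soundness′ p (I′ , models) = I° , soundness _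
    where open Soundness zero Γ (slotCount φ) p I′ φ models
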